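{- Let $P\subset\mathbb{R}^m$ be a full-dimensional totally unimodular polytope, $F$ a face of codimension $k$ with supporting facets $F_1,\dots,F_k$ having primitive outer normal vectors $n_1,\dots,n_k$. Fix a vertex $v$ of $F$; for each $i$ let $v_i$ be the vertex of $P$ adjacent to $v$ not in $F_i$, $d_i$ the primitive edge direction from $v$ to $v_i$, and $u_i$ the orthogonal projection of $d_i$ onto the orthogonal complement of $\mathrm{lin}(F)$. Let $C=(\langle n_i,n_j\rangle)_{1\le i,j\le k}$ and $M=(\langle u_i,u_j\rangle)_{1\le i,j\le k}$. Then $C$ and $M$ are inverse to one another.
   Context: $\langle\cdot,\cdot\rangle$ is the standard dot product. For a face $F$, $\mathrm{lin}(F)$ is the linear subspace parallel to its affine hull. A cone is unimodular if it is generated by a set of vectors extendable to a basis of $\mathbb{Z}^m$. A polytope is totally unimodular if it is integral and for every vertex $v$ the feasible cone $\mathrm{fcone}(v,P)=\{y: v+\epsilon y\in P\text{ for some }\epsilon>0\}$ is unimodular (such polytopes are simple, so $v_i$ is unique). A supporting facet of $F$ is a facet containing $F$. The primitive edge direction from $v$ to an adjacent vertex $w$ is the positive multiple of $w-v$ that is a primitive integer vector.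
   Formalization: Stated over ℚ^m instead of ℝ^m: the polytope P consists of rational points, and its faces, feasible cones, lin(F) and the projections u_i are taken over the rationals. -}

module Defs where

open import Data.Nat as ℕ using (ℕ; zero; suc)
open import Data.Nat.Divisibility using (_∣_)
open import Data.Integer as ℤ using (ℤ; ∣_∣)
open import Data.Rational using (ℚ; 0ℚ; 1ℚ; _+_; _*_; _-_; _≤_; _<_; _/_)
open import Data.Fin using (Fin; zero; suc; _≟_)
open import Data.Product using (Σ; ∃; _×_; _,_)
open import Data.Empty using (⊥)
open import Relation.Nullary using (¬_; yes; no)
open import Relation.Binary.PropositionalEquality using (_≡_; _≢_)

Vecℚ : ℕ → Set
Vecℚ m = Fin m → ℚ

Vecℤ : ℕ → Set
Vecℤ m = Fin m → ℤ

-- pointwise equality of vectors (avoids function extensionality)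
_≐_ : ∀ {m} → Vecℚ m → Vecℚ m → Set
_≐_ {m} x y = ∀ (i : Fin m) → x i ≡ y i

_≐ℤ_ : ∀ {m} → Vecℤ m → Vecℤ m → Set
_≐ℤ_ {m} x y = ∀ (i : Fin m) → x i ≡ y i

toℚ : ∀ {m} → Vecℤ m → Vecℚ m
toℚ z i = z i / 1

sumFin : (n : ℕ) → (Fin n → ℚ) → ℚ
sumFin zero    f = 0ℚ
sumFin (suc n) f = f zero + sumFin n (λ i → f (suc i))

sumFinℤ : (n : ℕ) → (Fin n → ℤ) → ℤ
sumFinℤ zero    f = ℤ.+ 0
sumFinℤ (suc n) f = f zero ℤ.+ sumFinℤ n (λ i → f (suc i))

⟨_,_⟩ : ∀ {m} → Vecℚ m → Vecℚ m → ℚ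
⟨_,_⟩ {m} x y = sumFin m (λ i → x i * y i)

_⊕_ : ∀ {m} → Vecℚ m → Vecℚ m → Vecℚ m
(x ⊕ y) i = x i + y i

_⊖_ : ∀ {m} → Vecℚ m → Vecℚ m → Vecℚ m
(x ⊖ y) i = x i - y i

_·_ : ∀ {m} → ℚ → Vecℚ m → Vecℚ m
(t · x) i = t * x i

0v : ∀ {m} → Vecℚ m
0v i = 0ℚ

lincomb : ∀ {m} (N : ℕ) → (Fin N → ℚ) → (Fin N → Vecℚ m) → Vecℚ m
lincomb N c w i = sumFin N (λ j → c j * w j i)

Pred : ℕ → Set₁
Pred m = Vecℚ m → Set

InConv : ∀ {m N} → (Fin N → Vecℚ m) → Pred m
InConv {m} {N} S x =
  Σ (Fin N → ℚ) λ λs → (∀ j → 0ℚ ≤ λs j) × (sumFin N λs ≡ 1ℚ) × (x ≐ lincomb N λs S)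

-- lin(X): linear span of all differences x - y with x, y ∈ X
InLin : ∀ {m} → Pred m → Pred m
InLin {m} X z =
  Σ ℕ λ N → Σ (Fin N → Vecℚ m) λ xs → Σ (Fin N → Vecℚ m) λ ys → Σ (Fin N → ℚ) λ c →
    (∀ j → X (xs j)) × (∀ j → X (ys j)) × (z ≐ lincomb N c (λ j → xs j ⊖ ys j))

LinIndep : ∀ {m d} → (Fin d → Vecℚ m) → Set
LinIndep {m} {d} w = ∀ (c : Fin d → ℚ) → lincomb d c w ≐ 0v → ∀ j → c j ≡ 0ℚ

-- dim X = d : dim lin(X) = d  (the dimension of the affine hull of X)
Dim : ∀ {m} → Pred m → ℕ → Set
Dim {m} X d =
  (Σ (Fin d → Vecℚ m) λ w → (∀ j → InLin X (w j)) × LinIndep w)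
  × (∀ (w : Fin (suc d) → Vecℚ m) → (∀ j → InLin X (w j)) → ¬ LinIndep w)

FaceSet : ∀ {m} → Pred m → Vecℚ m → ℚ → Pred m
FaceSet P a c x = P x × (⟨ a , x ⟩ ≡ c)

ValidIneq : ∀ {m} → Pred m → Vecℚ m → ℚ → Set
ValidIneq {m} P a c = ∀ (x : Vecℚ m) → P x → ⟨ a , x ⟩ ≤ c

SameSet : ∀ {m} → Pred m → Pred m → Set
SameSet {m} X Y = ∀ (x : Vecℚ m) → (X x → Y x) × (Y x → X x)

IsFace : ∀ {m} → Pred m → Pred m → Set
IsFace {m} P G = Σ (Vecℚ m) λ a → Σ ℚ λ c → ValidIneq P a c × SameSet G (FaceSet P a c)

IsVertex : ∀ {m} → Pred m → Vecℚ m → Set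
IsVertex P v = IsFace P (λ x → x ≐ v)

Segment : ∀ {m} → Vecℚ m → Vecℚ m → Pred m
Segment v w x = Σ ℚ λ t → (0ℚ ≤ t) × (t ≤ 1ℚ) × (x ≐ (v ⊕ (t · (w ⊖ v))))

Adjacent : ∀ {m} → Pred m → Vecℚ m → Vecℚ m → Set
Adjacent P v w = IsVertex P v × IsVertex P w × ¬ (v ≐ w) × IsFace P (Segment v w)

IsFacet : ∀ {m} → Pred m → Pred m → Set
IsFacet {m} P G = IsFace P G × (Σ (Vecℚ m) G) × Σ ℕ λ d → Dim G d × (suc d ≡ m)

IsPolytope : ∀ {m} → Pred m → Set
IsPolytope {m} P = Σ ℕ λ N → Σ (Fin N → Vecℚ m) λ S → SameSet P (InConv S)

FullDim : ∀ {m} → Pred m → Set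
FullDim {m} P = Dim P m

Primitive : ∀ {m} → Vecℤ m → Set
Primitive {m} z = ∀ (g : ℕ) → (∀ i → g ∣ ∣ z i ∣) → g ≡ 1

IsLatticeBasis : ∀ {m} → (Fin m → Vecℤ m) → Set
IsLatticeBasis {m} b =
  (∀ (z : Vecℤ m) → Σ (Fin m → ℤ) λ c → ∀ i → z i ≡ sumFinℤ m (λ j → c j ℤ.* b j i))
  × (∀ (c : Fin m → ℤ) → (∀ i → sumFinℤ m (λ j → c j ℤ.* b j i) ≡ ℤ.+ 0) → ∀ j → c j ≡ ℤ.+ 0)

FCone : ∀ {m} → Pred m → Vecℚ m → Pred m
FCone P v y = Σ ℚ λ ε → (0ℚ < ε) × P (v ⊕ (ε · y))

InConeGen : ∀ {m r} → (Fin r → Vecℚ m) → Pred m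
InConeGen {m} {r} g y = Σ (Fin r → ℚ) λ c → (∀ j → 0ℚ ≤ c j) × (y ≐ lincomb r c g)

-- a cone is unimodular: generated by vectors extendable to a basis of ℤ^m
-- (the generators are b ∘ ι for a lattice basis b and an injection ι)
IsUnimodularCone : ∀ {m} → Pred m → Set
IsUnimodularCone {m} K =
  Σ ℕ λ r → Σ (Fin m → Vecℤ m) λ b → Σ (Fin r → Fin m) λ ι →
    IsLatticeBasis b × (∀ j j' → ι j ≡ ι j' → j ≡ j')
    × SameSet K (InConeGen (λ j → toℚ (b (ι j))))

IsIntegral : ∀ {m} → Pred m → Set
IsIntegral {m} P = ∀ (v : Vecℚ m) → IsVertex P v → Σ (Vecℤ m) λ z → v ≐ toℚ z

IsTotallyUnimodular : ∀ {m} → Pred m → Set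
IsTotallyUnimodular {m} P =
  IsPolytope P × IsIntegral P × (∀ (v : Vecℚ m) → IsVertex P v → IsUnimodularCone (FCone P v))

Mat : ℕ → Set
Mat k = Fin k → Fin k → ℚ

_⊗_ : ∀ {k} → Mat k → Mat k → Mat k
_⊗_ {k} A B i j = sumFin k (λ l → A i l * B l j)

Id : ∀ {k} → Mat k
Id i j with i ≟ j
... | yes _ = 1ℚ
... | no _  = 0ℚ

-- At the vertex v the feasible cone is unimodular, and full dimensionality forces it to be
-- generated by an entire lattice basis B_1, …, B_m; let H_1, …, H_m be the (integral) dual basis,
-- so that x - v = Σ κ_l(x - v) B_l with κ_l = ⟨H_l, ·⟩ ≥ 0 for every x ∈ P.  A valid inequality
-- tight at v is non-positive on every B_l, so on its face every coordinate κ_l with ⟨a, B_l⟩ ≠ 0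
-- is constant.  For a facet a dimension count leaves a single such l = σ(i), and primitivity gives
-- n_i = -H_σ(i).  Likewise a primitive edge direction at v is a generator B_τ, and v_i ∉ F_i forces
-- d_i = B_σ(i).  Every other generator lies in lin F, as otherwise its coordinate facet would be a
-- further supporting facet of F.  Hence ⟨n_i, u_j⟩ = -δ_ij, and y_j = n_j + Σ_l C_jl u_l, being
-- orthogonal to lin F and to every n_i, has all products κ_p(y_j) ⟨y_j, B_p⟩ zero, so y_j = 0;
-- pairing with u_i yields CM = I.
module Submission where

module TotallyUnimodularPolytopes where

  open import Defs
  open import Data.Nat as ℕ using (ℕ; zero; suc)
  open import Data.Nat.Divisibility as ℕ using (_∣_)
  open import Data.Integer as ℤ using (ℤ; -[1+_])
  import Data.Integer.Properties as ℤₚ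
  open import Data.Rational as ℚ using (ℚ; 0ℚ; 1ℚ; _+_; _*_; _-_; -_; _≤_; _<_; mkℚ; ↥_)
  import Data.Rational.Properties as ℚₚ
  open import Data.Rational.Solver
  open import Data.Fin as Fin using (Fin; zero; suc; punchIn)
  import Data.Fin.Properties as Finₚ
  import Data.Nat.Coprimality as Coprime
  open import Data.Vec.Functional using (insertAt)
  open import Data.Vec.Functional.Properties using (insertAt-lookup; insertAt-punchIn)
  open import Data.Empty using (⊥-elim)
  open import Data.Product using (Σ; _×_; _,_; proj₁; proj₂)
  open import Data.Sum using (_⊎_; inj₁; inj₂)
  open import Relation.Binary using (tri<; tri≈; tri>)
  open import Relation.Binary.PropositionalEquality
  open import Relation.Nullary using (¬_; yes; no)
  open import Relation.Nullary.Decidable using (decidable-stable)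

  open +-*-Solver
  open ≡-Reasoning

  p-q≡0⇒p≡q : ∀ p q → p - q ≡ 0ℚ → p ≡ q
  p-q≡0⇒p≡q p q e = begin
    p             ≡⟨ solve 2 (λ p q → p := (p :- q) :+ q) refl p q ⟩
    (p - q) + q   ≡⟨ cong (_+ q) e ⟩
    0ℚ + q        ≡⟨ ℚₚ.+-identityˡ q ⟩
    q             ∎

  p≡q⇒p-q≡0 : ∀ {p q} → p ≡ q → p - q ≡ 0ℚ
  p≡q⇒p-q≡0 {p} refl = ℚₚ.+-inverseʳ p

  p*q≡0⇒q≡0 : ∀ p q → p ≢ 0ℚ → p * q ≡ 0ℚ → q ≡ 0ℚ
  p*q≡0⇒q≡0 p q p≢0 e = begin
    q              ≡⟨ ℚₚ.*-identityˡ q ⟨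
    1ℚ * q         ≡⟨ cong (_* q) (ℚₚ.*-inverseˡ p) ⟨
    (1/p * p) * q  ≡⟨ ℚₚ.*-assoc 1/p p q ⟩
    1/p * (p * q)  ≡⟨ cong (1/p *_) e ⟩
    1/p * 0ℚ       ≡⟨ ℚₚ.*-zeroʳ 1/p ⟩
    0ℚ             ∎
    where
    instance
      p-nonZero : ℚ.NonZero p
      p-nonZero = ℚ.≢-nonZero p≢0
    1/p : ℚ
    1/p = ℚ.1/ p

  p≢0∧q≢0⇒p*q≢0 : ∀ {p q} → p ≢ 0ℚ → q ≢ 0ℚ → p * q ≢ 0ℚ
  p≢0∧q≢0⇒p*q≢0 {p} {q} p≢0 q≢0 e = q≢0 (p*q≡0⇒q≡0 p q p≢0 e)

  p+q≡p⇒q≡0 : ∀ p q → p + q ≡ p → q ≡ 0ℚ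
  p+q≡p⇒q≡0 p q e = trans (solve 2 (λ p q → q := (p :+ q) :- p) refl p q) (p≡q⇒p-q≡0 e)

  p+q≤p⇒q≤0 : ∀ p q → p + q ≤ p → q ≤ 0ℚ
  p+q≤p⇒q≤0 p q h = subst₂ _≤_ (solve 2 (λ p q → (:- p) :+ (p :+ q) := q) refl p q)
    (ℚₚ.+-inverseˡ p) (ℚₚ.+-monoʳ-≤ (- p) h)

  nonNeg*nonPos⇒nonPos : ∀ p q → 0ℚ ≤ p → q ≤ 0ℚ → p * q ≤ 0ℚ
  nonNeg*nonPos⇒nonPos p q 0≤p q≤0 = ℚₚ.nonPositive⁻¹ (p * q)
    {{ℚₚ.nonNeg*nonPos⇒nonPos p {{ℚ.nonNegative 0≤p}} q {{ℚ.nonPositive q≤0}}}}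

  nonNeg*nonNeg⇒nonNeg : ∀ p q → 0ℚ ≤ p → 0ℚ ≤ q → 0ℚ ≤ p * q
  nonNeg*nonNeg⇒nonNeg p q 0≤p 0≤q = ℚₚ.nonNegative⁻¹ (p * q)
    {{ℚₚ.nonNeg*nonNeg⇒nonNeg p {{ℚ.nonNegative 0≤p}} q {{ℚ.nonNegative 0≤q}}}}

  p*p≥0 : ∀ p → 0ℚ ≤ p * p
  p*p≥0 p with ℚₚ.≤-total 0ℚ p
  ... | inj₁ 0≤p = nonNeg*nonNeg⇒nonNeg p p 0≤p 0≤p
  ... | inj₂ p≤0 = subst (0ℚ ≤_) (solve 1 (λ p → (:- p) :* (:- p) := p :* p) refl p)
    (nonNeg*nonNeg⇒nonNeg (- p) (- p) (ℚₚ.neg-antimono-≤ p≤0) (ℚₚ.neg-antimono-≤ p≤0))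

  p*p≡0⇒p≡0 : ∀ p → p * p ≡ 0ℚ → p ≡ 0ℚ
  p*p≡0⇒p≡0 p e with p ℚ.≟ 0ℚ
  ... | yes p≡0 = p≡0
  ... | no p≢0 = ⊥-elim (p≢0∧q≢0⇒p*q≢0 p≢0 p≢0 e)

  pos*p≤0⇒p≤0 : ∀ ε p → 0ℚ < ε → ε * p ≤ 0ℚ → p ≤ 0ℚ
  pos*p≤0⇒p≤0 ε p 0<ε h =
    ℚₚ.*-cancelˡ-≤-pos ε {{ℚ.positive 0<ε}} (subst (ε * p ≤_) (sym (ℚₚ.*-zeroʳ ε)) h)

  pos⇒≢0 : ∀ {ε} → 0ℚ < ε → ε ≢ 0ℚ
  pos⇒≢0 0<ε ε≡0 = ℚₚ.<-irrefl (sym ε≡0) 0<ε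

  ≤∧≢⇒< : ∀ {p q} → p ≤ q → p ≢ q → p < q
  ≤∧≢⇒< {p} {q} p≤q p≢q with ℚₚ.<-cmp p q
  ... | tri< p<q _ _ = p<q
  ... | tri≈ _ p≡q _ = ⊥-elim (p≢q p≡q)
  ... | tri> _ _ q<p = ⊥-elim (ℚₚ.<-irrefl refl (ℚₚ.<-≤-trans q<p p≤q))

  0≤p-q⇒-p≤-q : ∀ p q → 0ℚ ≤ p - q → - p ≤ - q
  0≤p-q⇒-p≤-q p q h = subst₂ _≤_ (ℚₚ.+-identityʳ (- p))
    (solve 2 (λ p q → (:- p) :+ (p :- q) := :- q) refl p q) (ℚₚ.+-monoʳ-≤ (- p) h)

  0<1 : 0ℚ < 1ℚ
  0<1 = ℚₚ.positive⁻¹ 1ℚ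

  sumFin-cong : ∀ n {f g : Fin n → ℚ} → (∀ i → f i ≡ g i) → sumFin n f ≡ sumFin n g
  sumFin-cong zero    f≗g = refl
  sumFin-cong (suc n) f≗g = cong₂ _+_ (f≗g zero) (sumFin-cong n (λ i → f≗g (suc i)))

  sumFin-zero : ∀ n {f : Fin n → ℚ} → (∀ i → f i ≡ 0ℚ) → sumFin n f ≡ 0ℚ
  sumFin-zero zero    f≗0 = refl
  sumFin-zero (suc n) f≗0 = cong₂ _+_ (f≗0 zero) (sumFin-zero n (λ i → f≗0 (suc i)))

  sumFin-+ : ∀ n (f g : Fin n → ℚ) → sumFin n (λ i → f i + g i) ≡ sumFin n f + sumFin n g
  sumFin-+ zero    f g = refl
  sumFin-+ (suc n) f g = trans (cong ((f zero + g zero) +_) (sumFin-+ n _ _))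
    (solve 4 (λ a b c d → (a :+ b) :+ (c :+ d) := (a :+ c) :+ (b :+ d)) refl (f zero) (g zero) _ _)

  sumFin-*ˡ : ∀ n c (f : Fin n → ℚ) → sumFin n (λ i → c * f i) ≡ c * sumFin n f
  sumFin-*ˡ zero    c f = sym (ℚₚ.*-zeroʳ c)
  sumFin-*ˡ (suc n) c f = trans (cong ((c * f zero) +_) (sumFin-*ˡ n c _))
    (sym (ℚₚ.*-distribˡ-+ c (f zero) _))

  sumFin-*ʳ : ∀ n c (f : Fin n → ℚ) → sumFin n (λ i → f i * c) ≡ sumFin n f * c
  sumFin-*ʳ n c f = trans (sumFin-cong n (λ i → ℚₚ.*-comm (f i) c))
    (trans (sumFin-*ˡ n c f) (ℚₚ.*-comm c _))

  sumFin-neg : ∀ n (f : Fin n → ℚ) → sumFin n (λ i → - f i) ≡ - sumFin n f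
  sumFin-neg zero    f = refl
  sumFin-neg (suc n) f = trans (cong ((- f zero) +_) (sumFin-neg n _))
    (sym (ℚₚ.neg-distrib-+ (f zero) _))

  sumFin-sub : ∀ n (f g : Fin n → ℚ) → sumFin n (λ i → f i - g i) ≡ sumFin n f - sumFin n g
  sumFin-sub n f g = trans (sumFin-+ n f (λ i → - g i)) (cong (sumFin n f +_) (sumFin-neg n g))

  sumFin-swap : ∀ n m (f : Fin n → Fin m → ℚ) →
    sumFin n (λ i → sumFin m (f i)) ≡ sumFin m (λ j → sumFin n (λ i → f i j))
  sumFin-swap zero    m f = sym (sumFin-zero m (λ _ → refl))
  sumFin-swap (suc n) m f = trans (cong (sumFin m (f zero) +_) (sumFin-swap n m (λ i → f (suc i))))
    (sym (sumFin-+ m (f zero) (λ j → sumFin n (λ i → f (suc i) j))))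

  sumFin-punchIn : ∀ n (p : Fin (suc n)) (f : Fin (suc n) → ℚ) →
    sumFin (suc n) f ≡ f p + sumFin n (λ i → f (punchIn p i))
  sumFin-punchIn n       zero    f = refl
  sumFin-punchIn (suc n) (suc p) f = trans (cong (f zero +_) (sumFin-punchIn n p (λ i → f (suc i))))
    (solve 3 (λ a b c → a :+ (b :+ c) := b :+ (a :+ c)) refl (f zero) (f (suc p)) _)

  sumFin-single : ∀ n (p : Fin n) (f : Fin n → ℚ) → (∀ q → q ≢ p → f q ≡ 0ℚ) → sumFin n f ≡ f p
  sumFin-single (suc n) p f f≗0 = begin
    sumFin (suc n) f                           ≡⟨ sumFin-punchIn n p f ⟩
    f p + sumFin n (λ i → f (punchIn p i))     ≡⟨ cong (f p +_) (sumFin-zero n (λ i → f≗0 _ (Finₚ.punchInᵢ≢i p i))) ⟩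
    f p + 0ℚ                                   ≡⟨ ℚₚ.+-identityʳ (f p) ⟩
    f p                                        ∎

  sumFin-nonNeg : ∀ n (f : Fin n → ℚ) → (∀ i → 0ℚ ≤ f i) → 0ℚ ≤ sumFin n f
  sumFin-nonNeg zero    f f≥0 = ℚₚ.≤-refl
  sumFin-nonNeg (suc n) f f≥0 = ℚₚ.+-mono-≤ (f≥0 zero) (sumFin-nonNeg n _ (λ i → f≥0 (suc i)))

  sumFin-nonPos : ∀ n (f : Fin n → ℚ) → (∀ i → f i ≤ 0ℚ) → sumFin n f ≤ 0ℚ
  sumFin-nonPos zero    f f≤0 = ℚₚ.≤-refl
  sumFin-nonPos (suc n) f f≤0 = ℚₚ.+-mono-≤ (f≤0 zero) (sumFin-nonPos n _ (λ i → f≤0 (suc i)))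

  nonPos+nonPos≡0⇒≡0 : ∀ p q → p ≤ 0ℚ → q ≤ 0ℚ → p + q ≡ 0ℚ → p ≡ 0ℚ
  nonPos+nonPos≡0⇒≡0 p q p≤0 q≤0 e = ℚₚ.≤-antisym p≤0 (subst (0ℚ ≤_) (sym p≡-q) (ℚₚ.neg-antimono-≤ q≤0))
    where
    p≡-q : p ≡ - q
    p≡-q = trans (solve 2 (λ p q → p := (p :+ q) :- q) refl p q)
      (trans (cong (_- q) e) (ℚₚ.+-identityˡ (- q)))

  sumFin-nonPos-≡0 : ∀ n (f : Fin n → ℚ) → (∀ i → f i ≤ 0ℚ) → sumFin n f ≡ 0ℚ → ∀ i → f i ≡ 0ℚ
  sumFin-nonPos-≡0 (suc n) f f≤0 e zero =
    nonPos+nonPos≡0⇒≡0 _ _ (f≤0 zero) (sumFin-nonPos n _ (λ i → f≤0 (suc i))) e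
  sumFin-nonPos-≡0 (suc n) f f≤0 e (suc i) = sumFin-nonPos-≡0 n _ (λ i → f≤0 (suc i))
    (nonPos+nonPos≡0⇒≡0 _ _ (sumFin-nonPos n _ (λ i → f≤0 (suc i))) (f≤0 zero)
      (trans (ℚₚ.+-comm _ (f zero)) e)) i

  sumFin-nonNeg-≡0 : ∀ n (f : Fin n → ℚ) → (∀ i → 0ℚ ≤ f i) → sumFin n f ≡ 0ℚ → ∀ i → f i ≡ 0ℚ
  sumFin-nonNeg-≡0 n f f≥0 e i = trans (solve 1 (λ a → a := :- (:- a)) refl (f i))
    (cong -_ (sumFin-nonPos-≡0 n (λ j → - f j) (λ j → ℚₚ.neg-antimono-≤ (f≥0 j))
      (trans (sumFin-neg n f) (cong -_ e)) i))

  Id-diag : ∀ {n} (p : Fin n) → Id p p ≡ 1ℚ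
  Id-diag p with p Fin.≟ p
  ... | yes _ = refl
  ... | no p≢p = ⊥-elim (p≢p refl)

  Id-off : ∀ {n} {p q : Fin n} → p ≢ q → Id p q ≡ 0ℚ
  Id-off {p = p} {q} p≢q with p Fin.≟ q
  ... | yes p≡q = ⊥-elim (p≢q p≡q)
  ... | no _ = refl

  Id-sym : ∀ {n} (p q : Fin n) → Id p q ≡ Id q p
  Id-sym p q with p Fin.≟ q
  ... | yes refl = sym (Id-diag p)
  ... | no p≢q = sym (Id-off (λ q≡p → p≢q (sym q≡p)))

  Id-nonNeg : ∀ {n} (p q : Fin n) → 0ℚ ≤ Id p q
  Id-nonNeg p q with p Fin.≟ q
  ... | yes _ = ℚₚ.nonNegative⁻¹ 1ℚ
  ... | no _  = ℚₚ.≤-refl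

  Id-injective : ∀ {n n′} {f : Fin n → Fin n′} → (∀ p q → f p ≡ f q → p ≡ q) →
    ∀ p q → Id (f p) (f q) ≡ Id p q
  Id-injective {f = f} f-inj p q with p Fin.≟ q
  ... | yes refl = Id-diag (f p)
  ... | no p≢q = Id-off (λ e → p≢q (f-inj p q e))

  sumFin-Idʳ : ∀ n (p : Fin n) (f : Fin n → ℚ) → sumFin n (λ q → f q * Id q p) ≡ f p
  sumFin-Idʳ n p f = trans
    (sumFin-single n p _ (λ q q≢p → trans (cong (f q *_) (Id-off q≢p)) (ℚₚ.*-zeroʳ (f q))))
    (trans (cong (f p *_) (Id-diag p)) (ℚₚ.*-identityʳ (f p)))

  sumFin-Idˡ : ∀ n (p : Fin n) (f : Fin n → ℚ) → sumFin n (λ q → Id p q * f q) ≡ f p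
  sumFin-Idˡ n p f = trans
    (sumFin-cong n (λ q → trans (ℚₚ.*-comm (Id p q) (f q)) (cong (f q *_) (Id-sym p q))))
    (sumFin-Idʳ n p f)

  neg : ∀ {m} → Vecℚ m → Vecℚ m
  neg x i = - x i

  dot-congˡ : ∀ {m} {x x′ : Vecℚ m} (y : Vecℚ m) → x ≐ x′ → ⟨ x , y ⟩ ≡ ⟨ x′ , y ⟩
  dot-congˡ {m} y x≐x′ = sumFin-cong m (λ i → cong (_* y i) (x≐x′ i))

  dot-congʳ : ∀ {m} (x : Vecℚ m) {y y′ : Vecℚ m} → y ≐ y′ → ⟨ x , y ⟩ ≡ ⟨ x , y′ ⟩
  dot-congʳ {m} x y≐y′ = sumFin-cong m (λ i → cong (x i *_) (y≐y′ i))

  dot-comm : ∀ {m} (x y : Vecℚ m) → ⟨ x , y ⟩ ≡ ⟨ y , x ⟩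
  dot-comm {m} x y = sumFin-cong m (λ i → ℚₚ.*-comm (x i) (y i))

  dot-zeroʳ : ∀ {m} (x : Vecℚ m) {y : Vecℚ m} → y ≐ 0v → ⟨ x , y ⟩ ≡ 0ℚ
  dot-zeroʳ {m} x y≐0 = sumFin-zero m (λ i → trans (cong (x i *_) (y≐0 i)) (ℚₚ.*-zeroʳ (x i)))

  dot-lincomb : ∀ {m} N (x : Vecℚ m) (c : Fin N → ℚ) (w : Fin N → Vecℚ m) →
    ⟨ x , lincomb N c w ⟩ ≡ sumFin N (λ j → c j * ⟨ x , w j ⟩)
  dot-lincomb {m} N x c w = begin
    sumFin m (λ i → x i * sumFin N (λ j → c j * w j i))
      ≡⟨ sumFin-cong m (λ i → sumFin-*ˡ N (x i) _) ⟨
    sumFin m (λ i → sumFin N (λ j → x i * (c j * w j i)))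
      ≡⟨ sumFin-swap m N _ ⟩
    sumFin N (λ j → sumFin m (λ i → x i * (c j * w j i)))
      ≡⟨ sumFin-cong N (λ j → trans (sumFin-cong m (λ i → x*[c*w]≡c*[x*w] (x i) (c j) (w j i)))
                                   (sumFin-*ˡ m (c j) _)) ⟩
    sumFin N (λ j → c j * ⟨ x , w j ⟩) ∎
    where
    x*[c*w]≡c*[x*w] : ∀ a b c → a * (b * c) ≡ b * (a * c)
    x*[c*w]≡c*[x*w] = solve 3 (λ a b c → a :* (b :* c) := b :* (a :* c)) refl

  dot-⊕ : ∀ {m} (x y z : Vecℚ m) → ⟨ x , y ⊕ z ⟩ ≡ ⟨ x , y ⟩ + ⟨ x , z ⟩
  dot-⊕ {m} x y z = trans (sumFin-cong m (λ i → ℚₚ.*-distribˡ-+ (x i) (y i) (z i))) (sumFin-+ m _ _)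

  dot-⊖ : ∀ {m} (x y z : Vecℚ m) → ⟨ x , y ⊖ z ⟩ ≡ ⟨ x , y ⟩ - ⟨ x , z ⟩
  dot-⊖ {m} x y z = trans
    (sumFin-cong m (λ i → solve 3 (λ a b c → a :* (b :- c) := a :* b :- a :* c) refl (x i) (y i) (z i)))
    (sumFin-sub m _ _)

  dot-· : ∀ {m} (x : Vecℚ m) t (y : Vecℚ m) → ⟨ x , t · y ⟩ ≡ t * ⟨ x , y ⟩
  dot-· {m} x t y = trans
    (sumFin-cong m (λ i → solve 3 (λ a b c → a :* (b :* c) := b :* (a :* c)) refl (x i) t (y i)))
    (sumFin-*ˡ m t _)

  dot-neg : ∀ {m} (x y : Vecℚ m) → ⟨ neg x , y ⟩ ≡ - ⟨ x , y ⟩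
  dot-neg {m} x y = trans
    (sumFin-cong m (λ i → solve 2 (λ a b → (:- a) :* b := :- (a :* b)) refl (x i) (y i)))
    (sumFin-neg m _)

  dot-translate : ∀ {m} (h v : Vecℚ m) ε y → ⟨ h , v ⊕ (ε · y) ⟩ ≡ ⟨ h , v ⟩ + ε * ⟨ h , y ⟩
  dot-translate h v ε y = trans (dot-⊕ h v (ε · y)) (cong (⟨ h , v ⟩ +_) (dot-· h ε y))

  dot-self≡0⇒≐0v : ∀ {m} (x : Vecℚ m) → ⟨ x , x ⟩ ≡ 0ℚ → x ≐ 0v
  dot-self≡0⇒≐0v {m} x e i = p*p≡0⇒p≡0 (x i) (sumFin-nonNeg-≡0 m _ (λ j → p*p≥0 (x j)) e i)

  Gram : ∀ {m k} → (Fin k → Vecℚ m) → Mat k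
  Gram x i j = ⟨ x i , x j ⟩

  -- Pairing N_j + Σ_l ⟨N_j,N_l⟩ u_l = 0 with u_i gives -δ_ji + (Gram N ⊗ Gram u)_ji = 0.
  Gram-inverse : ∀ {m k} (N u : Fin k → Vecℚ m) → (∀ i j → ⟨ N i , u j ⟩ ≡ - Id i j) →
    (∀ j → (N j ⊕ lincomb k (Gram N j) u) ≐ 0v) →
    (∀ i j → (Gram N ⊗ Gram u) i j ≡ Id i j) × (∀ i j → (Gram u ⊗ Gram N) i j ≡ Id i j)
  Gram-inverse {k = k} N u N-u relation =
    (λ i j → trans (sumFin-cong k (λ l → cong (Gram N i l *_) (dot-comm (u l) (u j)))) (CM≡Id j i)) ,
    (λ i j → trans (sumFin-cong k (λ l → trans (ℚₚ.*-comm (Gram u i l) (Gram N l j))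
                                               (cong (_* Gram u i l) (dot-comm (N l) (N j)))))
                   (trans (CM≡Id i j) (Id-sym j i)))
    where
    CM≡Id : ∀ i j → sumFin k (λ l → Gram N j l * Gram u i l) ≡ Id j i
    CM≡Id i j = p-q≡0⇒p≡q _ _ (begin
      sumFin k (λ l → Gram N j l * Gram u i l) - Id j i
        ≡⟨ solve 2 (λ S d → S :- d := (:- d) :+ S) refl _ (Id j i) ⟩
      - Id j i + sumFin k (λ l → Gram N j l * Gram u i l)
        ≡⟨ cong₂ _+_ (trans (sym (N-u j i)) (dot-comm (N j) (u i))) (sym (dot-lincomb k (u i) (Gram N j) u)) ⟩
      ⟨ u i , N j ⟩ + ⟨ u i , lincomb k (Gram N j) u ⟩
        ≡⟨ dot-⊕ (u i) (N j) (lincomb k (Gram N j) u) ⟨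
      ⟨ u i , N j ⊕ lincomb k (Gram N j) u ⟩
        ≡⟨ dot-zeroʳ (u i) (relation j) ⟩
      0ℚ ∎)

  -- Linear dependence

  Dependent : ∀ {m N} → (Fin N → Vecℚ m) → Set
  Dependent {m} {N} w = Σ (Fin N → ℚ) λ c → (Σ (Fin N) λ j → c j ≢ 0ℚ) × lincomb N c w ≐ 0v

  Dependent⇒¬LinIndep : ∀ {m N} {w : Fin N → Vecℚ m} → Dependent w → ¬ LinIndep w
  Dependent⇒¬LinIndep (c , (j , cⱼ≢0) , c·w≐0) indep = cⱼ≢0 (indep c c·w≐0 j)

  nonzero-or-zero : ∀ {n} (f : Fin n → ℚ) → (Σ (Fin n) λ j → f j ≢ 0ℚ) ⊎ (∀ j → f j ≡ 0ℚ)
  nonzero-or-zero {zero}  f = inj₂ (λ ())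
  nonzero-or-zero {suc n} f with f zero ℚ.≟ 0ℚ | nonzero-or-zero (λ j → f (suc j))
  ... | no f₀≢0 | _                = inj₁ (zero , f₀≢0)
  ... | yes _   | inj₁ (j , fⱼ≢0)  = inj₁ (suc j , fⱼ≢0)
  ... | yes f₀≡0 | inj₂ f≗0        = inj₂ λ { zero → f₀≡0 ; (suc j) → f≗0 j }

  private
    -- Both reduction steps of Gaussian elimination lift a relation among s + 1 vectors
    -- of ℚ^s to one among the s + 2 vectors of ℚ^(s + 1).

    dependent-zero-column : ∀ s (a : Fin (suc (suc s)) → Vecℚ (suc s)) → (∀ j → a j zero ≡ 0ℚ) →
      Dependent {s} (λ j t → a (suc j) (suc t)) → Dependent a
    dependent-zero-column s a column≡0 (c′ , (j , c′ⱼ≢0) , c′·a≐0) = c , (suc j , c′ⱼ≢0) , c·a≐0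
      where
      c : Fin (suc (suc s)) → ℚ
      c zero    = 0ℚ
      c (suc j) = c′ j
      c·a≐0 : lincomb (suc (suc s)) c a ≐ 0v
      c·a≐0 zero = trans (cong (_+ lincomb (suc s) c′ (λ j → a (suc j)) zero) (ℚₚ.*-zeroˡ (a zero zero)))
        (trans (ℚₚ.+-identityˡ _)
          (sumFin-zero (suc s) (λ j → trans (cong (c′ j *_) (column≡0 (suc j))) (ℚₚ.*-zeroʳ (c′ j)))))
      c·a≐0 (suc t) = trans (cong (_+ lincomb (suc s) c′ (λ j → a (suc j)) (suc t)) (ℚₚ.*-zeroˡ (a zero (suc t))))
        (trans (ℚₚ.+-identityˡ _) (c′·a≐0 t))

    module Pivot (s : ℕ) (a : Fin (suc (suc s)) → Vecℚ (suc s)) (p : Fin (suc (suc s))) where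

      α : ℚ
      α = a p zero

      β : Fin (suc s) → ℚ
      β j = a (punchIn p j) zero

      eliminated : Fin (suc s) → Vecℚ s
      eliminated j t = α * a (punchIn p j) (suc t) - β j * a p (suc t)

      -- The pivot row receives the coefficient -Σ c′ⱼ βⱼ, the others c′ⱼ α.
      module Lift (c′ : Fin (suc s) → ℚ) (c′·e≐0 : lincomb (suc s) c′ eliminated ≐ 0v) where

        Σc′β : ℚ
        Σc′β = sumFin (suc s) (λ j → c′ j * β j)

        c : Fin (suc (suc s)) → ℚ
        c = insertAt (λ j → c′ j * α) p (- Σc′β)

        split : ∀ t → lincomb (suc (suc s)) c a t
                    ≡ - Σc′β * a p t + sumFin (suc s) (λ j → (c′ j * α) * a (punchIn p j) t)
        split t = trans (sumFin-punchIn (suc s) p (λ j → c j * a j t))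
          (cong₂ _+_ (cong (_* a p t) (insertAt-lookup (λ j → c′ j * α) p (- Σc′β)))
                     (sumFin-cong (suc s) (λ j → cong (_* a (punchIn p j) t) (insertAt-punchIn (λ j → c′ j * α) p (- Σc′β) j))))

        c·a≐0 : lincomb (suc (suc s)) c a ≐ 0v
        c·a≐0 zero = begin
          lincomb (suc (suc s)) c a zero
            ≡⟨ split zero ⟩
          - Σc′β * α + sumFin (suc s) (λ j → (c′ j * α) * β j)
            ≡⟨ cong (- Σc′β * α +_) (trans
                 (sumFin-cong (suc s) (λ j → solve 3 (λ c a b → (c :* a) :* b := (c :* b) :* a) refl (c′ j) α (β j)))
                 (sumFin-*ʳ (suc s) α (λ j → c′ j * β j))) ⟩
          - Σc′β * α + Σc′β * α
            ≡⟨ solve 2 (λ S a → (:- S) :* a :+ S :* a := con 0ℚ) refl Σc′β α ⟩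
          0ℚ ∎
        c·a≐0 (suc t) = begin
          lincomb (suc (suc s)) c a (suc t)
            ≡⟨ split (suc t) ⟩
          - Σc′β * A + S
            ≡⟨ solve 3 (λ X A S → (:- X) :* A :+ S := S :- X :* A) refl Σc′β A S ⟩
          S - Σc′β * A
            ≡⟨ cong (λ x → S - x) (sumFin-*ʳ (suc s) A (λ j → c′ j * β j)) ⟨
          S - sumFin (suc s) (λ j → (c′ j * β j) * A)
            ≡⟨ sumFin-sub (suc s) (λ j → (c′ j * α) * a (punchIn p j) (suc t)) (λ j → (c′ j * β j) * A) ⟨
          sumFin (suc s) (λ j → (c′ j * α) * a (punchIn p j) (suc t) - (c′ j * β j) * A)
            ≡⟨ sumFin-cong (suc s) (λ j → solve 5 (λ c al x b A → (c :* al) :* x :- (c :* b) :* A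
                                                            := c :* (al :* x :- b :* A))
                                                refl (c′ j) α (a (punchIn p j) (suc t)) (β j) A) ⟩
          lincomb (suc s) c′ eliminated t
            ≡⟨ c′·e≐0 t ⟩
          0ℚ ∎
          where
          A : ℚ
          A = a p (suc t)
          S : ℚ
          S = sumFin (suc s) (λ j → (c′ j * α) * a (punchIn p j) (suc t))

      dependent-pivot : α ≢ 0ℚ → Dependent eliminated → Dependent a
      dependent-pivot α≢0 (c′ , (j , c′ⱼ≢0) , c′·e≐0) = c , (punchIn p j , cⱼ≢0) , c·a≐0
        where
        open Lift c′ c′·e≐0
        cⱼ≢0 : c (punchIn p j) ≢ 0ℚ
        cⱼ≢0 = subst (_≢ 0ℚ) (sym (insertAt-punchIn (λ j → c′ j * α) p (- Σc′β) j)) (p≢0∧q≢0⇒p*q≢0 c′ⱼ≢0 α≢0)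

  dependent-overfull : ∀ s (a : Fin (suc s) → Vecℚ s) → Dependent a
  dependent-overfull zero    a = (λ _ → 1ℚ) , (zero , λ ()) , (λ ())
  dependent-overfull (suc s) a with nonzero-or-zero (λ j → a j zero)
  ... | inj₂ column≡0   = dependent-zero-column s a column≡0 (dependent-overfull s (λ j t → a (suc j) (suc t)))
  ... | inj₁ (p , aₚ≢0) = Pivot.dependent-pivot s a p aₚ≢0 (dependent-overfull s (Pivot.eliminated s a p))

  dependent-in-span : ∀ {M s} (B : Fin s → Vecℚ M) (w : Fin (suc s) → Vecℚ M)
    (a : Fin (suc s) → Fin s → ℚ) → (∀ j → w j ≐ lincomb s (a j) B) → Dependent w
  dependent-in-span {M} {s} B w a w≐aB with dependent-overfull s a
  ... | c , nontrivial , c·a≐0 = c , nontrivial , c·w≐0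
    where
    c·w≐0 : lincomb (suc s) c w ≐ 0v
    c·w≐0 i = begin
      sumFin (suc s) (λ j → c j * w j i)
        ≡⟨ sumFin-cong (suc s) (λ j → cong (c j *_) (w≐aB j i)) ⟩
      sumFin (suc s) (λ j → c j * sumFin s (λ l → a j l * B l i))
        ≡⟨ sumFin-cong (suc s) (λ j → sumFin-*ˡ s (c j) (λ l → a j l * B l i)) ⟨
      sumFin (suc s) (λ j → sumFin s (λ l → c j * (a j l * B l i)))
        ≡⟨ sumFin-swap (suc s) s (λ j l → c j * (a j l * B l i)) ⟩
      sumFin s (λ l → sumFin (suc s) (λ j → c j * (a j l * B l i)))
        ≡⟨ sumFin-cong s (λ l → trans (sumFin-cong (suc s) (λ j → sym (ℚₚ.*-assoc (c j) (a j l) (B l i))))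
                                     (sumFin-*ʳ (suc s) (B l i) (λ j → c j * a j l))) ⟩
      sumFin s (λ l → lincomb (suc s) c a l * B l i)
        ≡⟨ sumFin-zero s (λ l → trans (cong (_* B l i) (c·a≐0 l)) (ℚₚ.*-zeroˡ (B l i))) ⟩
      0ℚ ∎

  lincomb-punchIn : ∀ {M s} (p : Fin (suc s)) (c : Fin (suc s) → ℚ) (B : Fin (suc s) → Vecℚ M) →
    c p ≡ 0ℚ → lincomb (suc s) c B ≐ lincomb s (λ l → c (punchIn p l)) (λ l → B (punchIn p l))
  lincomb-punchIn {s = s} p c B cₚ≡0 i = begin
    lincomb (suc s) c B i
      ≡⟨ sumFin-punchIn s p (λ l → c l * B l i) ⟩
    c p * B p i + lincomb s (λ l → c (punchIn p l)) (λ l → B (punchIn p l)) i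
      ≡⟨ cong (_+ lincomb s (λ l → c (punchIn p l)) (λ l → B (punchIn p l)) i)
              (trans (cong (_* B p i) cₚ≡0) (ℚₚ.*-zeroˡ (B p i))) ⟩
    0ℚ + lincomb s (λ l → c (punchIn p l)) (λ l → B (punchIn p l)) i
      ≡⟨ ℚₚ.+-identityˡ _ ⟩
    lincomb s (λ l → c (punchIn p l)) (λ l → B (punchIn p l)) i ∎

  ¬LinIndep-coordinate-vanishing : ∀ {M m n} → n ≡ m → (p : Fin m) (B : Fin m → Vecℚ M)
    (w : Fin n → Vecℚ M) (a : Fin n → Fin m → ℚ) →
    (∀ j → w j ≐ lincomb m (a j) B) → (∀ j → a j p ≡ 0ℚ) → ¬ LinIndep w
  ¬LinIndep-coordinate-vanishing {m = suc s} refl p B w a w≐aB aₚ≡0 =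
    Dependent⇒¬LinIndep {w = w} (dependent-in-span (λ l → B (punchIn p l)) w (λ j l → a j (punchIn p l))
      (λ j i → trans (w≐aB j i) (lincomb-punchIn p (a j) B (aₚ≡0 j) i)))

  Dim-coordinate-hyperplane : ∀ {M m d} → suc d ≡ m → (B H : Fin m → Vecℚ M) →
    (∀ q p → ⟨ H q , B p ⟩ ≡ Id q p) → (∀ x → x ≐ lincomb m (λ q → ⟨ H q , x ⟩) B) →
    (G : Pred M) (l : Fin m) → (∀ q → q ≢ l → InLin G (B q)) → (∀ z → InLin G z → ⟨ H l , z ⟩ ≡ 0ℚ) →
    Dim G d
  Dim-coordinate-hyperplane {d = d} refl B H dual expand G l B∈linG H⊥linG =
    ((λ t → B (punchIn l t)) , (λ t → B∈linG (punchIn l t) (Finₚ.punchInᵢ≢i l t)) , independent) ,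
    (λ w w∈linG → ¬LinIndep-coordinate-vanishing refl l B w (λ j q → ⟨ H q , w j ⟩)
                    (λ j → expand (w j)) (λ j → H⊥linG (w j) (w∈linG j)))
    where
    independent : LinIndep (λ t → B (punchIn l t))
    independent c c·B≐0 t = begin
      c t
        ≡⟨ sumFin-Idˡ d t c ⟨
      sumFin d (λ s → Id t s * c s)
        ≡⟨ sumFin-cong d (λ s → trans (cong (_* c s) (trans (sym (Id-injective (Finₚ.punchIn-injective l) t s))
                                                            (sym (dual (punchIn l t) (punchIn l s)))))
                                      (ℚₚ.*-comm _ (c s))) ⟩
      sumFin d (λ s → c s * ⟨ H (punchIn l t) , B (punchIn l s) ⟩)
        ≡⟨ dot-lincomb d (H (punchIn l t)) c (λ s → B (punchIn l s)) ⟨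
      ⟨ H (punchIn l t) , lincomb d c (λ s → B (punchIn l s)) ⟩
        ≡⟨ dot-zeroʳ (H (punchIn l t)) c·B≐0 ⟩
      0ℚ ∎

  InLin-orthogonal : ∀ {m} (X : Pred m) (h : Vecℚ m) c → (∀ x → X x → ⟨ h , x ⟩ ≡ c) →
    ∀ z → InLin X z → ⟨ h , z ⟩ ≡ 0ℚ
  InLin-orthogonal X h c h≡c z (N , xs , ys , coeff , Xxs , Xys , z≐) = begin
    ⟨ h , z ⟩
      ≡⟨ dot-congʳ h z≐ ⟩
    ⟨ h , lincomb N coeff (λ j → xs j ⊖ ys j) ⟩
      ≡⟨ dot-lincomb N h coeff (λ j → xs j ⊖ ys j) ⟩
    sumFin N (λ j → coeff j * ⟨ h , xs j ⊖ ys j ⟩)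
      ≡⟨ sumFin-zero N (λ j → trans (cong (coeff j *_) (difference≡0 j)) (ℚₚ.*-zeroʳ (coeff j))) ⟩
    0ℚ ∎
    where
    difference≡0 : ∀ j → ⟨ h , xs j ⊖ ys j ⟩ ≡ 0ℚ
    difference≡0 j = trans (dot-⊖ h (xs j) (ys j))
      (p≡q⇒p-q≡0 (trans (h≡c (xs j) (Xxs j)) (sym (h≡c (ys j) (Xys j)))))

  InLin-direction : ∀ {m} (X : Pred m) (v y : Vecℚ m) ε → ε ≢ 0ℚ → X v → X (v ⊕ (ε · y)) → InLin X y
  InLin-direction X v y ε ε≢0 Xv Xv+εy =
    1 , (λ _ → v ⊕ (ε · y)) , (λ _ → v) , (λ _ → 1/ε) , (λ _ → Xv+εy) , (λ _ → Xv) , y≐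
    where
    instance
      ε-nonZero : ℚ.NonZero ε
      ε-nonZero = ℚ.≢-nonZero ε≢0
    1/ε : ℚ
    1/ε = ℚ.1/ ε
    y≐ : y ≐ lincomb 1 (λ _ → 1/ε) (λ _ → (v ⊕ (ε · y)) ⊖ v)
    y≐ i = sym (begin
      1/ε * ((v i + ε * y i) - v i) + 0ℚ
        ≡⟨ solve 4 (λ d v e y → d :* ((v :+ e :* y) :- v) :+ con 0ℚ := (d :* e) :* y) refl 1/ε (v i) ε (y i) ⟩
      (1/ε * ε) * y i
        ≡⟨ cong (_* y i) (ℚₚ.*-inverseˡ ε) ⟩
      1ℚ * y i
        ≡⟨ ℚₚ.*-identityˡ (y i) ⟩
      y i ∎)

  fromℤ : ℤ → ℚ
  fromℤ z = z ℚ./ 1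

  private
    fromℤ-mkℚ : ∀ z → fromℤ z ≡ mkℚ z 0 (Coprime.sym (Coprime.1-coprimeTo _))
    fromℤ-mkℚ z = ℚₚ.↥p/↧p≡p (mkℚ z 0 (Coprime.sym (Coprime.1-coprimeTo _)))

  fromℤ-+ : ∀ a b → fromℤ (a ℤ.+ b) ≡ fromℤ a + fromℤ b
  fromℤ-+ a b rewrite fromℤ-mkℚ a | fromℤ-mkℚ b =
    ℚₚ./-cong {p₁ = a ℤ.+ b} (cong₂ ℤ._+_ (sym (ℤₚ.*-identityʳ a)) (sym (ℤₚ.*-identityʳ b))) refl

  fromℤ-* : ∀ a b → fromℤ (a ℤ.* b) ≡ fromℤ a * fromℤ b
  fromℤ-* a b rewrite fromℤ-mkℚ a | fromℤ-mkℚ b = refl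

  fromℤ-neg : ∀ a → fromℤ (ℤ.- a) ≡ - fromℤ a
  fromℤ-neg a = trans (fromℤ-mkℚ (ℤ.- a)) (trans (mkℚ-neg a) (cong -_ (sym (fromℤ-mkℚ a))))
    where
    mkℚ-neg : ∀ a → mkℚ (ℤ.- a) 0 (Coprime.sym (Coprime.1-coprimeTo _)) ≡ - mkℚ a 0 (Coprime.sym (Coprime.1-coprimeTo _))
    mkℚ-neg (ℤ.+ zero)  = refl
    mkℚ-neg (ℤ.+ suc n) = refl
    mkℚ-neg -[1+ n ]    = refl

  fromℤ-injective : ∀ {a b} → fromℤ a ≡ fromℤ b → a ≡ b
  fromℤ-injective {a} {b} e = cong ↥_ (trans (sym (fromℤ-mkℚ a)) (trans e (fromℤ-mkℚ b)))

  fromℤ-sumFinℤ : ∀ n (f : Fin n → ℤ) → fromℤ (sumFinℤ n f) ≡ sumFin n (λ i → fromℤ (f i))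
  fromℤ-sumFinℤ zero    f = refl
  fromℤ-sumFinℤ (suc n) f =
    trans (fromℤ-+ (f zero) _) (cong (fromℤ (f zero) +_) (fromℤ-sumFinℤ n (λ i → f (suc i))))

  fromℤ-neg-< : ∀ a → fromℤ a < 0ℚ → a ℤ.< ℤ.+ 0
  fromℤ-neg-< a h with subst (_< 0ℚ) (fromℤ-mkℚ a) h
  ... | ℚ.*<* a*1<0 = subst (ℤ._< ℤ.+ 0) (ℤₚ.*-identityʳ a) a*1<0

  fromℤ-pos-< : ∀ a → 0ℚ < fromℤ a → ℤ.+ 0 ℤ.< a
  fromℤ-pos-< a h with subst (0ℚ <_) (fromℤ-mkℚ a) h
  ... | ℚ.*<* 0<a*1 = subst (ℤ.+ 0 ℤ.<_) (ℤₚ.*-identityʳ a) 0<a*1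

  dot-toℚ : ∀ {m} (x y : Vecℤ m) → ⟨ toℚ x , toℚ y ⟩ ≡ fromℤ (sumFinℤ m (λ i → x i ℤ.* y i))
  dot-toℚ {m} x y = sym (trans (fromℤ-sumFinℤ m _) (sumFin-cong m (λ i → fromℤ-* (x i) (y i))))

  Primitive-scalar-unit : ∀ {m} (z y : Vecℤ m) (A : ℤ) → Primitive z → (∀ j → z j ≡ A ℤ.* y j) → ℤ.∣ A ∣ ≡ 1
  Primitive-scalar-unit z y A prim z≡Ay = prim ℤ.∣ A ∣ (λ j → subst (ℤ.∣ A ∣ ∣_)
    (sym (trans (cong ℤ.∣_∣ (z≡Ay j)) (ℤₚ.abs-* A (y j)))) (ℕ.m∣m*n ℤ.∣ y j ∣))

  ∣i∣≡1∧i<0⇒i≡-1 : ∀ A → ℤ.∣ A ∣ ≡ 1 → A ℤ.< ℤ.+ 0 → A ≡ -[1+ 0 ]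
  ∣i∣≡1∧i<0⇒i≡-1 -[1+ zero ]  _  _           = refl
  ∣i∣≡1∧i<0⇒i≡-1 -[1+ suc n ] () _
  ∣i∣≡1∧i<0⇒i≡-1 (ℤ.+ n)      _  (ℤ.+<+ ())

  ∣i∣≡1∧0<i⇒i≡1 : ∀ A → ℤ.∣ A ∣ ≡ 1 → ℤ.+ 0 ℤ.< A → A ≡ ℤ.+ 1
  ∣i∣≡1∧0<i⇒i≡1 (ℤ.+ suc zero)    _  _          = refl
  ∣i∣≡1∧0<i⇒i≡1 (ℤ.+ suc (suc n)) () _
  ∣i∣≡1∧0<i⇒i≡1 (ℤ.+ zero)        _  (ℤ.+<+ ())
  ∣i∣≡1∧0<i⇒i≡1 -[1+ n ]          _  ()

  Primitive⇒≢0 : ∀ {m} (z : Vecℤ m) → Primitive z → ¬ (∀ j → z j ≡ ℤ.+ 0)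
  Primitive⇒≢0 z prim z≡0 with prim 0 (λ j → subst (λ t → 0 ∣ ℤ.∣ t ∣) (sym (z≡0 j)) ℕ.∣-refl)
  ... | ()

  -- The dual of a lattice basis

  module DualBasis {m} (L : Fin m → Vecℤ m) (basis : IsLatticeBasis L) where

    B : Fin m → Vecℚ m
    B p = toℚ (L p)

    private
      unit : Fin m → Vecℤ m
      unit i j with i Fin.≟ j
      ... | yes _ = ℤ.+ 1
      ... | no _  = ℤ.+ 0

      fromℤ-unit : ∀ i j → fromℤ (unit i j) ≡ Id i j
      fromℤ-unit i j with i Fin.≟ j
      ... | yes _ = refl
      ... | no _  = refl

    coordinate : Fin m → Fin m → ℤ
    coordinate i = proj₁ (proj₁ basis (unit i))

    -- H l is integral: its i-th entry is the l-th coordinate of the i-th unit vector in the basis L.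
    H : Fin m → Vecℚ m
    H l i = fromℤ (coordinate i l)

    private
      unit-expansion : ∀ i j → Id i j ≡ sumFin m (λ l → H l i * B l j)
      unit-expansion i j = begin
        Id i j                                                   ≡⟨ fromℤ-unit i j ⟨
        fromℤ (unit i j)                                         ≡⟨ cong fromℤ (proj₂ (proj₁ basis (unit i)) j) ⟩
        fromℤ (sumFinℤ m (λ l → coordinate i l ℤ.* L l j))       ≡⟨ fromℤ-sumFinℤ m _ ⟩
        sumFin m (λ l → fromℤ (coordinate i l ℤ.* L l j))        ≡⟨ sumFin-cong m (λ l → fromℤ-* (coordinate i l) (L l j)) ⟩
        sumFin m (λ l → H l i * B l j)                           ∎

    expand-H : ∀ (x : Vecℚ m) → x ≐ lincomb m (λ l → ⟨ x , B l ⟩) H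
    expand-H x i = sym (begin
      sumFin m (λ l → sumFin m (λ t → x t * B l t) * H l i)
        ≡⟨ sumFin-cong m (λ l → trans (sym (sumFin-*ʳ m (H l i) (λ t → x t * B l t)))
             (sumFin-cong m (λ t → solve 3 (λ x b h → (x :* b) :* h := x :* (h :* b)) refl (x t) (B l t) (H l i)))) ⟩
      sumFin m (λ l → sumFin m (λ t → x t * (H l i * B l t)))
        ≡⟨ sumFin-swap m m (λ l t → x t * (H l i * B l t)) ⟩
      sumFin m (λ t → sumFin m (λ l → x t * (H l i * B l t)))
        ≡⟨ sumFin-cong m (λ t → sumFin-*ˡ m (x t) (λ l → H l i * B l t)) ⟩
      sumFin m (λ t → x t * sumFin m (λ l → H l i * B l t))
        ≡⟨ sumFin-cong m (λ t → cong (x t *_) (trans (sym (unit-expansion i t)) (Id-sym i t))) ⟩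
      sumFin m (λ t → x t * Id t i)
        ≡⟨ sumFin-Idʳ m i x ⟩
      x i ∎)

    κ : Fin m → Vecℚ m → ℚ
    κ l x = ⟨ H l , x ⟩

    expand-B : ∀ (x : Vecℚ m) → x ≐ lincomb m (λ l → κ l x) B
    expand-B x i = sym (begin
      sumFin m (λ l → sumFin m (λ t → H l t * x t) * B l i)
        ≡⟨ sumFin-cong m (λ l → trans (sym (sumFin-*ʳ m (B l i) (λ t → H l t * x t)))
             (sumFin-cong m (λ t → solve 3 (λ h x b → (h :* x) :* b := x :* (h :* b)) refl (H l t) (x t) (B l i)))) ⟩
      sumFin m (λ l → sumFin m (λ t → x t * (H l t * B l i)))
        ≡⟨ sumFin-swap m m (λ l t → x t * (H l t * B l i)) ⟩
      sumFin m (λ t → sumFin m (λ l → x t * (H l t * B l i)))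
        ≡⟨ sumFin-cong m (λ t → sumFin-*ˡ m (x t) (λ l → H l t * B l i)) ⟩
      sumFin m (λ t → x t * sumFin m (λ l → H l t * B l i))
        ≡⟨ sumFin-cong m (λ t → cong (x t *_) (sym (unit-expansion t i))) ⟩
      sumFin m (λ t → x t * Id t i)
        ≡⟨ sumFin-Idʳ m i x ⟩
      x i ∎)

    -- The integer vector of the differences ⟨H l, B p⟩ - δ_lp has zero combination with L,
    -- so it vanishes by the uniqueness part of the lattice basis property.
    private
      module Defect (p : Fin m) where

        defect : Fin m → ℤ
        defect l = sumFinℤ m (λ t → coordinate t l ℤ.* L p t) ℤ.- unit l p

        fromℤ-defect : ∀ l → fromℤ (defect l) ≡ ⟨ H l , B p ⟩ - Id l p
        fromℤ-defect l = begin
          fromℤ (defect l)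
            ≡⟨ fromℤ-+ (sumFinℤ m (λ t → coordinate t l ℤ.* L p t)) (ℤ.- unit l p) ⟩
          fromℤ (sumFinℤ m (λ t → coordinate t l ℤ.* L p t)) + fromℤ (ℤ.- unit l p)
            ≡⟨ cong₂ _+_ (trans (fromℤ-sumFinℤ m _) (sumFin-cong m (λ t → fromℤ-* (coordinate t l) (L p t))))
                         (fromℤ-neg (unit l p)) ⟩
          ⟨ H l , B p ⟩ - fromℤ (unit l p)
            ≡⟨ cong (λ q → ⟨ H l , B p ⟩ - q) (fromℤ-unit l p) ⟩
          ⟨ H l , B p ⟩ - Id l p ∎

        defect·L≡0 : ∀ i → sumFinℤ m (λ l → defect l ℤ.* L l i) ≡ ℤ.+ 0
        defect·L≡0 i = fromℤ-injective (begin
          fromℤ (sumFinℤ m (λ l → defect l ℤ.* L l i))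
            ≡⟨ fromℤ-sumFinℤ m _ ⟩
          sumFin m (λ l → fromℤ (defect l ℤ.* L l i))
            ≡⟨ sumFin-cong m (λ l → trans (fromℤ-* (defect l) (L l i)) (cong (_* B l i) (fromℤ-defect l))) ⟩
          sumFin m (λ l → (⟨ H l , B p ⟩ - Id l p) * B l i)
            ≡⟨ trans (sumFin-cong m (λ l → solve 3 (λ x y z → (x :- y) :* z := x :* z :- y :* z) refl
                                                       ⟨ H l , B p ⟩ (Id l p) (B l i)))
                     (sumFin-sub m (λ l → ⟨ H l , B p ⟩ * B l i) (λ l → Id l p * B l i)) ⟩
          sumFin m (λ l → ⟨ H l , B p ⟩ * B l i) - sumFin m (λ l → Id l p * B l i)
            ≡⟨ cong₂ _-_ (sym (expand-B (B p) i))
                         (trans (sumFin-cong m (λ l → cong (_* B l i) (Id-sym l p))) (sumFin-Idˡ m p (λ l → B l i))) ⟩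
          B p i - B p i
            ≡⟨ ℚₚ.+-inverseʳ (B p i) ⟩
          0ℚ ∎)

    dual : ∀ l p → ⟨ H l , B p ⟩ ≡ Id l p
    dual l p = p-q≡0⇒p≡q _ _ (trans (sym (fromℤ-defect l)) (cong fromℤ (proj₂ basis defect defect·L≡0 l)))
      where open Defect p

  -- The feasible cone at a vertex of a totally unimodular polytope

  Fin⇒≡suc : ∀ {m} → Fin m → Σ ℕ λ d → suc d ≡ m
  Fin⇒≡suc {suc d} _ = d , refl

  IsPolytope⇒resp-≐ : ∀ {m} {P : Pred m} → IsPolytope P → ∀ {x y} → x ≐ y → P x → P y
  IsPolytope⇒resp-≐ (N , S , P≡conv) {x} {y} x≐y Px with proj₁ (P≡conv x) Px
  ... | λs , λs≥0 , Σλs≡1 , x≐ = proj₂ (P≡conv y) (λs , λs≥0 , Σλs≡1 , λ i → trans (sym (x≐y i)) (x≐ i))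

  IsFace⇒member : ∀ {m} {P G : Pred m} → IsFace P G → ∀ {x} → G x → P x
  IsFace⇒member (a , c , _ , G≡face) {x} Gx = proj₁ (proj₁ (G≡face x) Gx)

  IsVertex⇒member : ∀ {m} {P : Pred m} {v} → IsVertex P v → P v
  IsVertex⇒member vertex = IsFace⇒member vertex (λ _ → refl)

  module VertexCone {m} (P : Pred m) (tu : IsTotallyUnimodular P) (full : FullDim P)
                    (v : Vecℚ m) (vertex : IsVertex P v) where

    P-resp-≐ : ∀ {x y} → x ≐ y → P x → P y
    P-resp-≐ = IsPolytope⇒resp-≐ (proj₁ tu)

    Pv : P v
    Pv = IsVertex⇒member vertex

    private
      unimodular : IsUnimodularCone (FCone P v)
      unimodular = proj₂ (proj₂ tu) v vertex

      r : ℕ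
      r = proj₁ unimodular

      L : Fin m → Vecℤ m
      L = proj₁ (proj₂ unimodular)

      ι : Fin r → Fin m
      ι = proj₁ (proj₂ (proj₂ unimodular))

      basis : IsLatticeBasis L
      basis = proj₁ (proj₂ (proj₂ (proj₂ unimodular)))

      cone≡ : SameSet (FCone P v) (InConeGen (λ j → toℚ (L (ι j))))
      cone≡ = proj₂ (proj₂ (proj₂ (proj₂ (proj₂ unimodular))))

    open DualBasis L basis public

    P⇒FCone : ∀ x → P x → FCone P v (x ⊖ v)
    P⇒FCone x Px = 1ℚ , 0<1 , P-resp-≐ (λ i → solve 2 (λ x v → x := v :+ con 1ℚ :* (x :- v)) refl (x i) (v i)) Px

    FCone-coordinates : ∀ y → FCone P v y →
      Σ (Fin r → ℚ) λ cs → (∀ j → 0ℚ ≤ cs j) × (∀ p → κ p y ≡ sumFin r (λ j → cs j * Id p (ι j)))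
    FCone-coordinates y y∈cone with proj₁ (cone≡ y) y∈cone
    ... | cs , cs≥0 , y≐ = cs , cs≥0 , λ p → begin
      κ p y                                          ≡⟨ dot-congʳ (H p) y≐ ⟩
      κ p (lincomb r cs (λ j → B (ι j)))             ≡⟨ dot-lincomb r (H p) cs (λ j → B (ι j)) ⟩
      sumFin r (λ j → cs j * κ p (B (ι j)))          ≡⟨ sumFin-cong r (λ j → cong (cs j *_) (dual p (ι j))) ⟩
      sumFin r (λ j → cs j * Id p (ι j))             ∎

    private
      module Coordinates (y : Vecℚ m) (y∈cone : FCone P v y) where
        cs : Fin r → ℚ
        cs = proj₁ (FCone-coordinates y y∈cone)
        cs≥0 : ∀ j → 0ℚ ≤ cs j
        cs≥0 = proj₁ (proj₂ (FCone-coordinates y y∈cone))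
        κ≡ : ∀ p → κ p y ≡ sumFin r (λ j → cs j * Id p (ι j))
        κ≡ = proj₂ (proj₂ (FCone-coordinates y y∈cone))

    FCone⇒κ-nonNeg : ∀ y → FCone P v y → ∀ p → 0ℚ ≤ κ p y
    FCone⇒κ-nonNeg y y∈cone p = subst (0ℚ ≤_) (sym (κ≡ p))
      (sumFin-nonNeg r (λ j → cs j * Id p (ι j)) (λ j → nonNeg*nonNeg⇒nonNeg (cs j) (Id p (ι j)) (cs≥0 j) (Id-nonNeg p (ι j))))
      where open Coordinates y y∈cone

    FCone⇒κ-non-generator≡0 : ∀ y → FCone P v y → ∀ p → (∀ j → ι j ≢ p) → κ p y ≡ 0ℚ
    FCone⇒κ-non-generator≡0 y y∈cone p p∉ι = trans (κ≡ p)
      (sumFin-zero r (λ j → trans (cong (cs j *_) (Id-off (λ p≡ιj → p∉ι j (sym p≡ιj)))) (ℚₚ.*-zeroʳ (cs j))))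
      where open Coordinates y y∈cone

    κ-nonNeg : ∀ x → P x → ∀ p → 0ℚ ≤ κ p (x ⊖ v)
    κ-nonNeg x Px = FCone⇒κ-nonNeg (x ⊖ v) (P⇒FCone x Px)

    -- Full dimensionality forces every basis vector to be a generator of the feasible cone:
    -- otherwise κ p would vanish on P - v, hence on the m independent vectors spanning lin P.
    ι-surjective : ∀ p → Σ (Fin r) λ j → ι j ≡ p
    ι-surjective p with Finₚ.any? (λ j → ι j Fin.≟ p)
    ... | yes p∈ι = p∈ι
    ... | no p∉ι = ⊥-elim (¬LinIndep-coordinate-vanishing refl p B spanning (λ j q → κ q (spanning j))
            (λ j → expand-B (spanning j)) (λ j → κₚ⊥linP (spanning j) (spanning∈linP j)) independent)
      where
      spanning : Fin m → Vecℚ m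
      spanning = proj₁ (proj₁ full)
      spanning∈linP : ∀ j → InLin P (spanning j)
      spanning∈linP = proj₁ (proj₂ (proj₁ full))
      independent : LinIndep spanning
      independent = proj₂ (proj₂ (proj₁ full))
      κₚ-constant : ∀ x → P x → κ p x ≡ κ p v
      κₚ-constant x Px = p-q≡0⇒p≡q _ _ (trans (sym (dot-⊖ (H p) x v))
        (FCone⇒κ-non-generator≡0 (x ⊖ v) (P⇒FCone x Px) p (λ j ιj≡p → p∉ι (j , ιj≡p))))
      κₚ⊥linP : ∀ z → InLin P z → κ p z ≡ 0ℚ
      κₚ⊥linP = InLin-orthogonal P (H p) (κ p v) κₚ-constant

    generator-feasible : ∀ p → Σ ℚ λ ε → (0ℚ < ε) × P (v ⊕ (ε · B p))
    generator-feasible p with ι-surjective p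
    ... | j , refl = proj₂ (cone≡ (B (ι j))) (Id j , Id-nonNeg j , λ i → sym (sumFin-Idˡ r j (λ j′ → B (ι j′) i)))

    ε : Fin m → ℚ
    ε p = proj₁ (generator-feasible p)

    0<ε : ∀ p → 0ℚ < ε p
    0<ε p = proj₁ (proj₂ (generator-feasible p))

    step : Fin m → Vecℚ m
    step p = v ⊕ (ε p · B p)

    P-step : ∀ p → P (step p)
    P-step p = proj₂ (proj₂ (generator-feasible p))

    κ-step : ∀ l p → κ l (step p) ≡ κ l v + ε p * Id l p
    κ-step l p = trans (dot-translate (H l) v (ε p) (B p)) (cong (λ z → κ l v + ε p * z) (dual l p))

    tight⇒nonPos : ∀ a c → ValidIneq P a c → ⟨ a , v ⟩ ≡ c → ∀ p → ⟨ a , B p ⟩ ≤ 0ℚ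
    tight⇒nonPos a c valid tight p = pos*p≤0⇒p≤0 (ε p) ⟨ a , B p ⟩ (0<ε p)
      (p+q≤p⇒q≤0 c (ε p * ⟨ a , B p ⟩)
        (subst (_≤ c) (trans (dot-translate a v (ε p) (B p)) (cong (_+ ε p * ⟨ a , B p ⟩) tight))
          (valid (step p) (P-step p))))

    -- On a face through v, x - v = Σ κ_p(x - v) B_p is a sum of non-positive terms after pairing with a.
    tight-face-coordinates : ∀ a c → ValidIneq P a c → ⟨ a , v ⟩ ≡ c → ∀ {x} → P x → ⟨ a , x ⟩ ≡ c →
      ∀ p → κ p (x ⊖ v) * ⟨ a , B p ⟩ ≡ 0ℚ
    tight-face-coordinates a c valid tight {x} Px on-face = sumFin-nonPos-≡0 m _
      (λ p → nonNeg*nonPos⇒nonPos _ _ (κ-nonNeg x Px p) (tight⇒nonPos a c valid tight p)) (begin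
        sumFin m (λ p → κ p (x ⊖ v) * ⟨ a , B p ⟩)      ≡⟨ dot-lincomb m a (λ p → κ p (x ⊖ v)) B ⟨
        ⟨ a , lincomb m (λ p → κ p (x ⊖ v)) B ⟩          ≡⟨ dot-congʳ a (expand-B (x ⊖ v)) ⟨
        ⟨ a , x ⊖ v ⟩                                    ≡⟨ dot-⊖ a x v ⟩
        ⟨ a , x ⟩ - ⟨ a , v ⟩                            ≡⟨ p≡q⇒p-q≡0 (trans on-face (sym tight)) ⟩
        0ℚ                                               ∎)

    κ-constant-on-face : ∀ a c → ValidIneq P a c → ⟨ a , v ⟩ ≡ c → ∀ {x} → P x → ⟨ a , x ⟩ ≡ c →
      ∀ p → ⟨ a , B p ⟩ ≢ 0ℚ → κ p x ≡ κ p v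
    κ-constant-on-face a c valid tight {x} Px on-face p aBₚ≢0 = p-q≡0⇒p≡q _ _ (trans (sym (dot-⊖ (H p) x v))
      (p*q≡0⇒q≡0 ⟨ a , B p ⟩ (κ p (x ⊖ v)) aBₚ≢0
        (trans (ℚₚ.*-comm ⟨ a , B p ⟩ _) (tight-face-coordinates a c valid tight Px on-face p))))

    -- {x ∈ P : κ l x = κ l v}, cut out by -H l since κ l x ≥ κ l v on P
    coordinateFacet : Fin m → Pred m
    coordinateFacet l = FaceSet P (neg (H l)) ⟨ neg (H l) , v ⟩

    coordinateFacet-intro : ∀ l {x} → P x → κ l x ≡ κ l v → coordinateFacet l x
    coordinateFacet-intro l {x} Px κx≡κv =
      Px , trans (dot-neg (H l) x) (trans (cong -_ κx≡κv) (sym (dot-neg (H l) v)))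

    coordinateFacet-κ : ∀ l {x} → coordinateFacet l x → κ l x ≡ κ l v
    coordinateFacet-κ l {x} (_ , on-facet) =
      ℚₚ.neg-injective (trans (sym (dot-neg (H l) x)) (trans on-facet (dot-neg (H l) v)))

    step∈coordinateFacet : ∀ l p → l ≢ p → coordinateFacet l (step p)
    step∈coordinateFacet l p l≢p = coordinateFacet-intro l (P-step p) (begin
      κ l (step p)               ≡⟨ κ-step l p ⟩
      κ l v + ε p * Id l p       ≡⟨ cong (λ z → κ l v + ε p * z) (Id-off l≢p) ⟩
      κ l v + ε p * 0ℚ           ≡⟨ cong (κ l v +_) (ℚₚ.*-zeroʳ (ε p)) ⟩
      κ l v + 0ℚ                 ≡⟨ ℚₚ.+-identityʳ (κ l v) ⟩
      κ l v                      ∎)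

    coordinateFacet-isFacet : ∀ l → IsFacet P (coordinateFacet l)
    coordinateFacet-isFacet l =
      (neg (H l) , ⟨ neg (H l) , v ⟩ , valid , (λ x → (λ g → g) , (λ g → g))) ,
      (v , coordinateFacet-intro l Pv refl) ,
      proj₁ (Fin⇒≡suc l) ,
      Dim-coordinate-hyperplane (proj₂ (Fin⇒≡suc l)) B H dual expand-B (coordinateFacet l) l
        (λ q q≢l → InLin-direction (coordinateFacet l) v (B q) (ε q) (pos⇒≢0 (0<ε q))
                     (coordinateFacet-intro l Pv refl) (step∈coordinateFacet l q (λ l≡q → q≢l (sym l≡q))))
        (InLin-orthogonal (coordinateFacet l) (H l) (κ l v) (λ x → coordinateFacet-κ l)) ,
      proj₂ (Fin⇒≡suc l)
      where
      valid : ValidIneq P (neg (H l)) ⟨ neg (H l) , v ⟩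
      valid x Px = subst₂ _≤_ (sym (dot-neg (H l) x)) (sym (dot-neg (H l) v))
        (0≤p-q⇒-p≤-q (κ l x) (κ l v) (subst (0ℚ ≤_) (dot-⊖ (H l) x v) (κ-nonNeg x Px l)))

    private
      module FacetCoordinates (a : Vecℚ m) (c : ℚ) (valid : ValidIneq P a c) (tight : ⟨ a , v ⟩ ≡ c)
                              (facet : IsFacet P (FaceSet P a c)) where

        d : ℕ
        d = proj₁ (proj₂ (proj₂ facet))

        facet-basis : Fin d → Vecℚ m
        facet-basis = proj₁ (proj₁ (proj₁ (proj₂ (proj₂ (proj₂ facet)))))

        facet-basis∈lin : ∀ j → InLin (FaceSet P a c) (facet-basis j)
        facet-basis∈lin = proj₁ (proj₂ (proj₁ (proj₁ (proj₂ (proj₂ (proj₂ facet))))))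

        facet-basis-independent : LinIndep facet-basis
        facet-basis-independent = proj₂ (proj₂ (proj₁ (proj₁ (proj₂ (proj₂ (proj₂ facet))))))

        κ⊥lin-facet : ∀ q → ⟨ a , B q ⟩ ≢ 0ℚ → ∀ z → InLin (FaceSet P a c) z → κ q z ≡ 0ℚ
        κ⊥lin-facet q aB≢0 = InLin-orthogonal (FaceSet P a c) (H q) (κ q v)
          (λ x (Px , on-facet) → κ-constant-on-face a c valid tight Px on-facet q aB≢0)

        extended : Fin m → Fin (suc d) → Vecℚ m
        extended p zero    = B p
        extended p (suc j) = facet-basis j

        -- κ p separates B p from the facet directions
        extended-independent : ∀ p → ⟨ a , B p ⟩ ≢ 0ℚ → LinIndep (extended p)
        extended-independent p aBₚ≢0 cs cs·e≐0 = λ { zero → cs₀≡0 ; (suc j) → facet-basis-independent (λ j → cs (suc j)) rest≐0 j }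
          where
          cs₀≡0 : cs zero ≡ 0ℚ
          cs₀≡0 = begin
            cs zero
              ≡⟨ ℚₚ.*-identityʳ (cs zero) ⟨
            cs zero * 1ℚ
              ≡⟨ cong (cs zero *_) (trans (dual p p) (Id-diag p)) ⟨
            cs zero * κ p (B p)
              ≡⟨ ℚₚ.+-identityʳ _ ⟨
            cs zero * κ p (B p) + 0ℚ
              ≡⟨ cong (cs zero * κ p (B p) +_) (sumFin-zero d (λ j → trans
                   (cong (cs (suc j) *_) (κ⊥lin-facet p aBₚ≢0 (facet-basis j) (facet-basis∈lin j)))
                   (ℚₚ.*-zeroʳ (cs (suc j))))) ⟨
            sumFin (suc d) (λ j → cs j * κ p (extended p j))
              ≡⟨ dot-lincomb (suc d) (H p) cs (extended p) ⟨
            κ p (lincomb (suc d) cs (extended p))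
              ≡⟨ dot-zeroʳ (H p) cs·e≐0 ⟩
            0ℚ ∎
          rest≐0 : lincomb d (λ j → cs (suc j)) facet-basis ≐ 0v
          rest≐0 t = trans (sym (ℚₚ.+-identityˡ _))
            (trans (cong (_+ lincomb d (λ j → cs (suc j)) facet-basis t)
                         (sym (trans (cong (_* B p t) cs₀≡0) (ℚₚ.*-zeroˡ (B p t)))))
                   (cs·e≐0 t))

        single-coordinate : ∀ p q → ⟨ a , B p ⟩ ≢ 0ℚ → q ≢ p → ⟨ a , B q ⟩ ≡ 0ℚ
        single-coordinate p q aBₚ≢0 q≢p with ⟨ a , B q ⟩ ℚ.≟ 0ℚ
        ... | yes aB_q≡0 = aB_q≡0
        ... | no aB_q≢0 = ⊥-elim (¬LinIndep-coordinate-vanishing (proj₂ (proj₂ (proj₂ (proj₂ facet)))) q B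
                (extended p) (λ j l → κ l (extended p j)) (λ j → expand-B (extended p j)) κ_q≡0
                (extended-independent p aBₚ≢0))
          where
          κ_q≡0 : ∀ j → κ q (extended p j) ≡ 0ℚ
          κ_q≡0 zero    = trans (dual q p) (Id-off q≢p)
          κ_q≡0 (suc j) = κ⊥lin-facet q aB_q≢0 (facet-basis j) (facet-basis∈lin j)

    -- The normal is a multiple α H_σ of a single dual vector; primitivity makes α = ±1, and
    -- α = ⟨ n , B σ ⟩ ≤ 0 because the inequality is tight at v.
    facet-normal : ∀ (n : Vecℤ m) b → ValidIneq P (toℚ n) b → ⟨ toℚ n , v ⟩ ≡ b →
      IsFacet P (FaceSet P (toℚ n) b) → Primitive n → Σ (Fin m) λ σ → toℚ n ≐ neg (H σ)
    facet-normal n b valid tight facet prim with nonzero-or-zero (λ q → ⟨ toℚ n , B q ⟩)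
    ... | inj₂ nB≡0 = ⊥-elim (Primitive⇒≢0 n prim λ j → fromℤ-injective (trans (expand-H (toℚ n) j)
            (sumFin-zero m (λ l → trans (cong (_* H l j) (nB≡0 l)) (ℚₚ.*-zeroˡ (H l j))))))
    ... | inj₁ (σ , nBσ≢0) = σ , n≐-Hσ
      where
      open FacetCoordinates (toℚ n) b valid tight facet
      α : ℚ
      α = ⟨ toℚ n , B σ ⟩
      n≐αHσ : ∀ j → toℚ n j ≡ α * H σ j
      n≐αHσ j = trans (expand-H (toℚ n) j) (sumFin-single m σ (λ l → ⟨ toℚ n , B l ⟩ * H l j)
        (λ q q≢σ → trans (cong (_* H q j) (single-coordinate σ q nBσ≢0 q≢σ)) (ℚₚ.*-zeroˡ (H q j))))
      A : ℤ
      A = sumFinℤ m (λ t → n t ℤ.* L σ t)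
      fromℤ-A : fromℤ A ≡ α
      fromℤ-A = sym (dot-toℚ n (L σ))
      n≡A*coordinate : ∀ j → n j ≡ A ℤ.* coordinate j σ
      n≡A*coordinate j = fromℤ-injective (trans (n≐αHσ j)
        (trans (cong (_* H σ j) (sym fromℤ-A)) (sym (fromℤ-* A (coordinate j σ)))))
      A≡-1 : A ≡ -[1+ 0 ]
      A≡-1 = ∣i∣≡1∧i<0⇒i≡-1 A (Primitive-scalar-unit n (λ j → coordinate j σ) A prim n≡A*coordinate)
        (fromℤ-neg-< A (subst (_< 0ℚ) (sym fromℤ-A)
          (≤∧≢⇒< (tight⇒nonPos (toℚ n) b valid tight σ) nBσ≢0)))
      n≐-Hσ : toℚ n ≐ neg (H σ)
      n≐-Hσ j = trans (n≐αHσ j) (trans (cong (_* H σ j) (trans (sym fromℤ-A) (cong fromℤ A≡-1)))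
        (solve 1 (λ h → (:- con 1ℚ) :* h := :- h) refl (H σ j)))

    -- If κ τ (w - v) ≠ 0 then the inequality cutting out the edge is tight along B τ.
    generator-on-edge : ∀ w → Adjacent P v w → ∀ τ → κ τ (w ⊖ v) ≢ 0ℚ → Segment v w (step τ)
    generator-on-edge w (_ , w-vertex , _ , a , c , valid , edge≡face) τ κτ≢0 =
      proj₂ (edge≡face (step τ)) (P-step τ , (begin
        ⟨ a , step τ ⟩                ≡⟨ dot-translate a v (ε τ) (B τ) ⟩
        ⟨ a , v ⟩ + ε τ * ⟨ a , B τ ⟩ ≡⟨ cong₂ (λ x y → x + ε τ * y) tight aBτ≡0 ⟩
        c + ε τ * 0ℚ                  ≡⟨ trans (cong (c +_) (ℚₚ.*-zeroʳ (ε τ))) (ℚₚ.+-identityʳ c) ⟩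
        c                             ∎))
      where
      on-edge : ∀ {x} → Segment v w x → ⟨ a , x ⟩ ≡ c
      on-edge {x} x∈edge = proj₂ (proj₁ (edge≡face x) x∈edge)
      tight : ⟨ a , v ⟩ ≡ c
      tight = on-edge (0ℚ , ℚₚ.≤-refl , ℚₚ.<⇒≤ 0<1 ,
        λ j → solve 2 (λ v w → v := v :+ con 0ℚ :* (w :- v)) refl (v j) (w j))
      aBτ≡0 : ⟨ a , B τ ⟩ ≡ 0ℚ
      aBτ≡0 = p*q≡0⇒q≡0 (κ τ (w ⊖ v)) ⟨ a , B τ ⟩ κτ≢0
        (tight-face-coordinates a c valid tight (IsVertex⇒member w-vertex)
          (on-edge (1ℚ , ℚₚ.<⇒≤ 0<1 , ℚₚ.≤-refl ,
            λ j → solve 2 (λ v w → w := v :+ con 1ℚ :* (w :- v)) refl (v j) (w j))) τ)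

    generator-on-segment⇒single-coordinate : ∀ w τ → Segment v w (step τ) → ∀ p → p ≢ τ → κ p (w ⊖ v) ≡ 0ℚ
    generator-on-segment⇒single-coordinate w τ (s , _ , _ , step≐) p p≢τ = p*q≡0⇒q≡0 s (κ p (w ⊖ v)) s≢0
      (trans (sym (εId≡sκ p)) (trans (cong (ε τ *_) (Id-off p≢τ)) (ℚₚ.*-zeroʳ (ε τ))))
      where
      εB≐s[w-v] : (ε τ · B τ) ≐ (s · (w ⊖ v))
      εB≐s[w-v] j = trans (solve 2 (λ v e → e := (v :+ e) :- v) refl (v j) (ε τ * B τ j))
        (trans (cong (_- v j) (step≐ j)) (solve 2 (λ v e → (v :+ e) :- v := e) refl (v j) (s * (w j - v j))))
      εId≡sκ : ∀ p → ε τ * Id p τ ≡ s * κ p (w ⊖ v)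
      εId≡sκ p = begin
        ε τ * Id p τ          ≡⟨ cong (ε τ *_) (dual p τ) ⟨
        ε τ * κ p (B τ)       ≡⟨ dot-· (H p) (ε τ) (B τ) ⟨
        κ p (ε τ · B τ)       ≡⟨ dot-congʳ (H p) εB≐s[w-v] ⟩
        κ p (s · (w ⊖ v))     ≡⟨ dot-· (H p) s (w ⊖ v) ⟩
        s * κ p (w ⊖ v)       ∎
      s≢0 : s ≢ 0ℚ
      s≢0 s≡0 = pos⇒≢0 (0<ε τ) (begin
        ε τ                   ≡⟨ ℚₚ.*-identityʳ (ε τ) ⟨
        ε τ * 1ℚ              ≡⟨ cong (ε τ *_) (Id-diag τ) ⟨
        ε τ * Id τ τ          ≡⟨ εId≡sκ τ ⟩
        s * κ τ (w ⊖ v)       ≡⟨ cong (_* κ τ (w ⊖ v)) s≡0 ⟩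
        0ℚ * κ τ (w ⊖ v)      ≡⟨ ℚₚ.*-zeroˡ (κ τ (w ⊖ v)) ⟩
        0ℚ                    ∎)

    edge-single-coordinate : ∀ w → Adjacent P v w →
      Σ (Fin m) λ τ → (κ τ (w ⊖ v) ≢ 0ℚ) × (∀ p → p ≢ τ → κ p (w ⊖ v) ≡ 0ℚ)
    edge-single-coordinate w adjacent@(_ , _ , v≉w , _) with nonzero-or-zero (λ p → κ p (w ⊖ v))
    ... | inj₂ κ≡0 = ⊥-elim (v≉w (λ j → sym (p-q≡0⇒p≡q (w j) (v j) (trans (expand-B (w ⊖ v) j)
            (sumFin-zero m (λ l → trans (cong (_* B l j) (κ≡0 l)) (ℚₚ.*-zeroˡ (B l j))))))))
    ... | inj₁ (τ , κτ≢0) =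
      τ , κτ≢0 , generator-on-segment⇒single-coordinate w τ (generator-on-edge w adjacent τ κτ≢0)

    edge-generator : ∀ w → Adjacent P v w → (dir : Vecℤ m) → Primitive dir → ∀ t → 0ℚ < t →
      toℚ dir ≐ (t · (w ⊖ v)) → Σ (Fin m) λ τ → toℚ dir ≐ B τ
    edge-generator w adjacent dir prim t 0<t dir≐t[w-v] with edge-single-coordinate w adjacent
    ... | τ , κτ≢0 , κ≡0 = τ , dir≐Bτ
      where
      κ-dir : ∀ p → κ p (toℚ dir) ≡ t * κ p (w ⊖ v)
      κ-dir p = trans (dot-congʳ (H p) dir≐t[w-v]) (dot-· (H p) t (w ⊖ v))
      β : ℚ
      β = κ τ (toℚ dir)
      dir≐βBτ : ∀ j → toℚ dir j ≡ β * B τ j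
      dir≐βBτ j = trans (expand-B (toℚ dir) j) (sumFin-single m τ (λ p → κ p (toℚ dir) * B p j)
        (λ p p≢τ → trans (cong (_* B p j) (trans (κ-dir p) (trans (cong (t *_) (κ≡0 p p≢τ)) (ℚₚ.*-zeroʳ t))))
                         (ℚₚ.*-zeroˡ (B p j))))
      0<β : 0ℚ < β
      0<β = subst (0ℚ <_) (sym (κ-dir τ)) (≤∧≢⇒<
        (nonNeg*nonNeg⇒nonNeg t _ (ℚₚ.<⇒≤ 0<t) (κ-nonNeg w (IsVertex⇒member (proj₁ (proj₂ adjacent))) τ))
        (λ 0≡tκ → p≢0∧q≢0⇒p*q≢0 (pos⇒≢0 0<t) κτ≢0 (sym 0≡tκ)))
      A : ℤ
      A = sumFinℤ m (λ s → coordinate s τ ℤ.* dir s)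
      fromℤ-A : fromℤ A ≡ β
      fromℤ-A = sym (dot-toℚ (λ s → coordinate s τ) dir)
      dir≡A*L : ∀ j → dir j ≡ A ℤ.* L τ j
      dir≡A*L j = fromℤ-injective (trans (dir≐βBτ j)
        (trans (cong (_* B τ j) (sym fromℤ-A)) (sym (fromℤ-* A (L τ j)))))
      A≡1 : A ≡ ℤ.+ 1
      A≡1 = ∣i∣≡1∧0<i⇒i≡1 A (Primitive-scalar-unit dir (L τ) A prim dir≡A*L)
        (fromℤ-pos-< A (subst (0ℚ <_) (sym fromℤ-A) 0<β))
      dir≐Bτ : toℚ dir ≐ B τ
      dir≐Bτ j = trans (cong fromℤ (dir≡A*L j)) (trans (fromℤ-* A (L τ j))
        (trans (cong (λ z → fromℤ z * B τ j) A≡1) (ℚₚ.*-identityˡ (B τ j))))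

  -- The supporting facets of a face through a vertex

  module SupportingFacets
    {m k : ℕ} (P : Pred m) (tu : IsTotallyUnimodular P) (full : FullDim P)
    (F : Pred m) (F-face : IsFace P F)
    (n : Fin k → Vecℤ m) (b : Fin k → ℚ)
    (valid : ∀ i → ValidIneq P (toℚ (n i)) (b i))
    (facet : ∀ i → IsFacet P (FaceSet P (toℚ (n i)) (b i)))
    (n-primitive : ∀ i → Primitive (n i))
    (supporting : ∀ i (x : Vecℚ m) → F x → FaceSet P (toℚ (n i)) (b i) x)
    (distinct : ∀ i j → SameSet (FaceSet P (toℚ (n i)) (b i)) (FaceSet P (toℚ (n j)) (b j)) → i ≡ j)
    (complete : ∀ (G : Pred m) → IsFacet P G → (∀ x → F x → G x) →
                  Σ (Fin k) λ i → SameSet G (FaceSet P (toℚ (n i)) (b i)))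
    (v : Vecℚ m) (Fv : F v) (vertex : IsVertex P v) where

    open VertexCone P tu full v vertex

    N : Fin k → Vecℚ m
    N i = toℚ (n i)

    N-tight : ∀ i → ⟨ N i , v ⟩ ≡ b i
    N-tight i = proj₂ (supporting i v Fv)

    σ : Fin k → Fin m
    σ i = proj₁ (facet-normal (n i) (b i) (valid i) (N-tight i) (facet i) (n-primitive i))

    N≐-Hσ : ∀ i → N i ≐ neg (H (σ i))
    N≐-Hσ i = proj₂ (facet-normal (n i) (b i) (valid i) (N-tight i) (facet i) (n-primitive i))

    N-κ : ∀ i x → ⟨ N i , x ⟩ ≡ - κ (σ i) x
    N-κ i x = trans (dot-congˡ x (N≐-Hσ i)) (dot-neg (H (σ i)) x)

    N-B : ∀ i q → ⟨ N i , B q ⟩ ≡ - Id (σ i) q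
    N-B i q = trans (N-κ i (B q)) (cong -_ (dual (σ i) q))

    σ-injective : ∀ i j → σ i ≡ σ j → i ≡ j
    σ-injective i j σi≡σj = distinct i j (λ x → (λ (Px , on-i) → Px , trans (sym (Nx x)) (trans on-i bᵢ≡bⱼ)) ,
                                                (λ (Px , on-j) → Px , trans (Nx x) (trans on-j (sym bᵢ≡bⱼ))))
      where
      Nx : ∀ x → ⟨ N i , x ⟩ ≡ ⟨ N j , x ⟩
      Nx x = trans (N-κ i x) (trans (cong (λ q → - κ q x) σi≡σj) (sym (N-κ j x)))
      bᵢ≡bⱼ : b i ≡ b j
      bᵢ≡bⱼ = trans (sym (N-tight i)) (trans (Nx v) (N-tight j))

    N⊥linF : ∀ i z → InLin F z → ⟨ N i , z ⟩ ≡ 0ℚ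
    N⊥linF i = InLin-orthogonal F (N i) (b i) (λ x Fx → proj₂ (supporting i x Fx))

    N-step : ∀ i → ⟨ N i , step (σ i) ⟩ ≡ b i - ε (σ i)
    N-step i = begin
      ⟨ N i , step (σ i) ⟩                        ≡⟨ dot-translate (N i) v (ε (σ i)) (B (σ i)) ⟩
      ⟨ N i , v ⟩ + ε (σ i) * ⟨ N i , B (σ i) ⟩   ≡⟨ cong₂ (λ x y → x + ε (σ i) * y) (N-tight i)
                                                           (trans (N-B i (σ i)) (cong -_ (Id-diag (σ i)))) ⟩
      b i + ε (σ i) * - 1ℚ                        ≡⟨ solve 2 (λ b e → b :+ e :* (:- con 1ℚ) := b :- e) refl (b i) (ε (σ i)) ⟩
      b i - ε (σ i)                               ∎

    private
      a : Vecℚ m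
      a = proj₁ F-face
      c : ℚ
      c = proj₁ (proj₂ F-face)
      F-valid : ValidIneq P a c
      F-valid = proj₁ (proj₂ (proj₂ F-face))
      F≡face : SameSet F (FaceSet P a c)
      F≡face = proj₂ (proj₂ (proj₂ F-face))
      F-tight : ⟨ a , v ⟩ ≡ c
      F-tight = proj₂ (proj₁ (F≡face v) Fv)

    -- If ⟨ a , B l ⟩ ≠ 0, the coordinate facet of l contains F, so it is some F_i; but
    -- v + ε B_σi lies on it and not on F_i.
    F-non-normal-generator : ∀ l → (∀ i → σ i ≢ l) → ⟨ a , B l ⟩ ≡ 0ℚ
    F-non-normal-generator l l∉σ = decidable-stable (⟨ a , B l ⟩ ℚ.≟ 0ℚ) (λ aBₗ≢0 →
      not-some-Fᵢ (complete (coordinateFacet l) (coordinateFacet-isFacet l) (F⊆coordinateFacet aBₗ≢0)))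
      where
      F⊆coordinateFacet : ⟨ a , B l ⟩ ≢ 0ℚ → ∀ x → F x → coordinateFacet l x
      F⊆coordinateFacet aBₗ≢0 x Fx with proj₁ (F≡face x) Fx
      ... | Px , on-F = coordinateFacet-intro l Px (κ-constant-on-face a c F-valid F-tight Px on-F l aBₗ≢0)
      not-some-Fᵢ : ¬ (Σ (Fin k) λ i → SameSet (coordinateFacet l) (FaceSet P (N i) (b i)))
      not-some-Fᵢ (i , same) = pos⇒≢0 (0<ε (σ i)) (ℚₚ.neg-injective {ε (σ i)} {0ℚ} (p+q≡p⇒q≡0 (b i) (- ε (σ i))
        (trans (sym (N-step i))
          (proj₂ (proj₁ (same (step (σ i))) (step∈coordinateFacet l (σ i) (λ l≡σi → l∉σ i (sym l≡σi))))))))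

    non-normal-generator∈linF : ∀ l → (∀ i → σ i ≢ l) → InLin F (B l)
    non-normal-generator∈linF l l∉σ = InLin-direction F v (B l) (ε l) (pos⇒≢0 (0<ε l)) Fv
      (proj₂ (F≡face (step l)) (P-step l , (begin
        ⟨ a , step l ⟩                  ≡⟨ dot-translate a v (ε l) (B l) ⟩
        ⟨ a , v ⟩ + ε l * ⟨ a , B l ⟩   ≡⟨ cong₂ (λ x y → x + ε l * y) F-tight (F-non-normal-generator l l∉σ) ⟩
        c + ε l * 0ℚ                    ≡⟨ trans (cong (c +_) (ℚₚ.*-zeroʳ (ε l))) (ℚₚ.+-identityʳ c) ⟩
        c                               ∎)))

    -- Pairing y with its own expansion Σ κ_p(y) B_p: normal directions B_σi are killed by the
    -- κ-coordinates, the others by orthogonality to lin F.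
    ⊥-linF-normals⇒≐0 : ∀ y → (∀ z → InLin F z → ⟨ y , z ⟩ ≡ 0ℚ) → (∀ i → ⟨ N i , y ⟩ ≡ 0ℚ) → y ≐ 0v
    ⊥-linF-normals⇒≐0 y y⊥linF N⊥y = dot-self≡0⇒≐0v y (begin
      ⟨ y , y ⟩                                 ≡⟨ dot-congʳ y (expand-B y) ⟩
      ⟨ y , lincomb m (λ p → κ p y) B ⟩         ≡⟨ dot-lincomb m y (λ p → κ p y) B ⟩
      sumFin m (λ p → κ p y * ⟨ y , B p ⟩)      ≡⟨ sumFin-zero m term≡0 ⟩
      0ℚ                                        ∎)
      where
      term≡0 : ∀ p → κ p y * ⟨ y , B p ⟩ ≡ 0ℚ
      term≡0 p with Finₚ.any? (λ i → σ i Fin.≟ p)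
      ... | yes (i , refl) = trans (cong (_* ⟨ y , B (σ i) ⟩)
              (ℚₚ.neg-injective {κ (σ i) y} {0ℚ} (trans (sym (N-κ i y)) (N⊥y i)))) (ℚₚ.*-zeroˡ ⟨ y , B (σ i) ⟩)
      ... | no p∉σ = trans (cong (κ p y *_) (y⊥linF (B p) (non-normal-generator∈linF p (λ i σi≡p → p∉σ (i , σi≡p)))))
                           (ℚₚ.*-zeroʳ (κ p y))

    module _ (w : Fin k → Vecℚ m) (adjacent : ∀ i → Adjacent P v (w i))
             (w∉Fᵢ : ∀ i → ¬ FaceSet P (toℚ (n i)) (b i) (w i))
             (dir : Fin k → Vecℤ m) (dir-primitive : ∀ i → Primitive (dir i))
             (dir-edge : ∀ i → Σ ℚ λ t → (0ℚ < t) × (toℚ (dir i) ≐ (t · (w i ⊖ v)))) where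

      -- An edge direction B τ with τ ≠ σ i would keep w i on the facet F_i.
      dir≐Bσ : ∀ i → toℚ (dir i) ≐ B (σ i)
      dir≐Bσ i = along-σ (edge-generator (w i) (adjacent i) (dir i) (dir-primitive i) t 0<t dir≐t[w-v])
        where
        t : ℚ
        t = proj₁ (dir-edge i)
        0<t : 0ℚ < t
        0<t = proj₁ (proj₂ (dir-edge i))
        dir≐t[w-v] : toℚ (dir i) ≐ (t · (w i ⊖ v))
        dir≐t[w-v] = proj₂ (proj₂ (dir-edge i))
        N-w≡b : ∀ τ → toℚ (dir i) ≐ B τ → τ ≢ σ i → ⟨ N i , w i ⟩ ≡ b i
        N-w≡b τ dir≐Bτ τ≢σi = trans (p-q≡0⇒p≡q _ _ (p*q≡0⇒q≡0 t _ (pos⇒≢0 0<t) (begin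
          t * (⟨ N i , w i ⟩ - ⟨ N i , v ⟩)   ≡⟨ cong (t *_) (dot-⊖ (N i) (w i) v) ⟨
          t * ⟨ N i , w i ⊖ v ⟩               ≡⟨ dot-· (N i) t (w i ⊖ v) ⟨
          ⟨ N i , t · (w i ⊖ v) ⟩             ≡⟨ dot-congʳ (N i) dir≐t[w-v] ⟨
          ⟨ N i , toℚ (dir i) ⟩               ≡⟨ dot-congʳ (N i) dir≐Bτ ⟩
          ⟨ N i , B τ ⟩                       ≡⟨ N-B i τ ⟩
          - Id (σ i) τ                        ≡⟨ cong -_ (Id-off (λ σi≡τ → τ≢σi (sym σi≡τ))) ⟩
          0ℚ                                  ∎))) (N-tight i)
        along-σ : (Σ (Fin m) λ τ → toℚ (dir i) ≐ B τ) → toℚ (dir i) ≐ B (σ i)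
        along-σ (τ , dir≐Bτ) j = trans (dir≐Bτ j) (cong (λ q → B q j) (decidable-stable (τ Fin.≟ σ i)
          (λ τ≢σi → w∉Fᵢ i (IsVertex⇒member (proj₁ (proj₂ (adjacent i))) , N-w≡b τ dir≐Bτ τ≢σi))))

      module _ (u : Fin k → Vecℚ m) (u⊥linF : ∀ i z → InLin F z → ⟨ u i , z ⟩ ≡ 0ℚ)
               (dir-u∈linF : ∀ i → InLin F (toℚ (dir i) ⊖ u i)) where

        N-u : ∀ i j → ⟨ N i , u j ⟩ ≡ - Id i j
        N-u i j = begin
          ⟨ N i , u j ⟩
            ≡⟨ dot-congʳ (N i) (λ t → solve 2 (λ d u → u := d :- (d :- u)) refl (D t) (u j t)) ⟩
          ⟨ N i , D ⊖ (D ⊖ u j) ⟩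
            ≡⟨ dot-⊖ (N i) D (D ⊖ u j) ⟩
          ⟨ N i , D ⟩ - ⟨ N i , D ⊖ u j ⟩
            ≡⟨ cong₂ _-_ (trans (dot-congʳ (N i) (dir≐Bσ j)) (N-B i (σ j))) (N⊥linF i (D ⊖ u j) (dir-u∈linF j)) ⟩
          - Id (σ i) (σ j) - 0ℚ
            ≡⟨ ℚₚ.+-identityʳ (- Id (σ i) (σ j)) ⟩
          - Id (σ i) (σ j)
            ≡⟨ cong -_ (Id-injective σ-injective i j) ⟩
          - Id i j ∎
          where
          D : Vecℚ m
          D = toℚ (dir j)

        relation-vector : Fin k → Vecℚ m
        relation-vector j = N j ⊕ lincomb k (Gram N j) u

        dot-relation-vector : ∀ j z →
          ⟨ z , relation-vector j ⟩ ≡ ⟨ z , N j ⟩ + sumFin k (λ l → Gram N j l * ⟨ z , u l ⟩)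
        dot-relation-vector j z = trans (dot-⊕ z (N j) (lincomb k (Gram N j) u))
          (cong (⟨ z , N j ⟩ +_) (dot-lincomb k z (Gram N j) u))

        relation-vector⊥linF : ∀ j z → InLin F z → ⟨ relation-vector j , z ⟩ ≡ 0ℚ
        relation-vector⊥linF j z z∈linF = begin
          ⟨ relation-vector j , z ⟩
            ≡⟨ trans (dot-comm (relation-vector j) z) (dot-relation-vector j z) ⟩
          ⟨ z , N j ⟩ + sumFin k (λ l → Gram N j l * ⟨ z , u l ⟩)
            ≡⟨ cong₂ _+_ (trans (dot-comm z (N j)) (N⊥linF j z z∈linF))
                         (sumFin-zero k (λ l → trans (cong (Gram N j l *_) (trans (dot-comm z (u l)) (u⊥linF l z z∈linF)))
                                                    (ℚₚ.*-zeroʳ (Gram N j l)))) ⟩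
          0ℚ + 0ℚ
            ≡⟨ ℚₚ.+-identityʳ 0ℚ ⟩
          0ℚ ∎

        N⊥relation-vector : ∀ i j → ⟨ N i , relation-vector j ⟩ ≡ 0ℚ
        N⊥relation-vector i j = begin
          ⟨ N i , relation-vector j ⟩
            ≡⟨ dot-relation-vector j (N i) ⟩
          Gram N i j + sumFin k (λ l → Gram N j l * ⟨ N i , u l ⟩)
            ≡⟨ cong (Gram N i j +_) (sumFin-cong k (λ l → trans (cong (Gram N j l *_) (trans (N-u i l) (cong -_ (Id-sym i l))))
                 (solve 2 (λ a d → a :* (:- d) := :- (a :* d)) refl (Gram N j l) (Id l i)))) ⟩
          Gram N i j + sumFin k (λ l → - (Gram N j l * Id l i))
            ≡⟨ cong (Gram N i j +_) (trans (sumFin-neg k (λ l → Gram N j l * Id l i)) (cong -_ (sumFin-Idʳ k i (Gram N j)))) ⟩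
          Gram N i j - Gram N j i
            ≡⟨ p≡q⇒p-q≡0 (dot-comm (N i) (N j)) ⟩
          0ℚ ∎

        relation-vector≐0 : ∀ j → relation-vector j ≐ 0v
        relation-vector≐0 j =
          ⊥-linF-normals⇒≐0 (relation-vector j) (relation-vector⊥linF j) (λ i → N⊥relation-vector i j)

        Gram-normals-inverse :
          (∀ i j → (Gram N ⊗ Gram u) i j ≡ Id i j) × (∀ i j → (Gram u ⊗ Gram N) i j ≡ Id i j)
        Gram-normals-inverse = Gram-inverse N u N-u relation-vector≐0

open import Defs
open import Data.Nat using (ℕ; _+_; zero; suc)
open import Data.Fin using (Fin; zero)
open import Data.Rational using (ℚ; 0ℚ; _<_)
open import Data.Product using (Σ; _×_; _,_; proj₁)
open import Relation.Nullary using (¬_)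
open import Relation.Binary.PropositionalEquality using (_≡_)
open TotallyUnimodularPolytopes using (IsVertex⇒member; module SupportingFacets)

corollary3p7 :
  ∀ {m k : ℕ} (P : Pred m) → IsTotallyUnimodular P → FullDim P →
  -- F a face of P of codimension k
  (F : Pred m) → IsFace P F → (d : ℕ) → Dim F d → d + k ≡ m →
  -- F_i = P ∩ {⟨n_i,x⟩ = b_i} facets with primitive outer normals n_i
  (n : Fin k → Vecℤ m) (b : Fin k → ℚ) →
  (∀ i → ValidIneq P (toℚ (n i)) (b i)) →
  (∀ i → IsFacet P (FaceSet P (toℚ (n i)) (b i))) →
  (∀ i → Primitive (n i)) →
  -- F_1, …, F_k are exactly the supporting facets of F, listed without repetition
  (∀ i (x : Vecℚ m) → F x → FaceSet P (toℚ (n i)) (b i) x) →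
  (∀ i j → SameSet (FaceSet P (toℚ (n i)) (b i)) (FaceSet P (toℚ (n j)) (b j)) → i ≡ j) →
  (∀ (G : Pred m) → IsFacet P G → (∀ x → F x → G x) →
    Σ (Fin k) λ i → SameSet G (FaceSet P (toℚ (n i)) (b i))) →
  -- v a vertex of F
  (v : Vecℚ m) → IsVertex F v →
  -- v_i adjacent to v, not in F_i
  (w : Fin k → Vecℚ m) → (∀ i → Adjacent P v (w i)) →
  (∀ i → ¬ FaceSet P (toℚ (n i)) (b i) (w i)) →
  -- d_i primitive edge direction from v to v_i
  (dir : Fin k → Vecℤ m) → (∀ i → Primitive (dir i)) →
  (∀ i → Σ ℚ λ t → (0ℚ < t) × (toℚ (dir i) ≐ (t · (w i ⊖ v)))) →
  -- u_i orthogonal projection of d_i onto lin(F)^⊥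
  (u : Fin k → Vecℚ m) →
  (∀ i (z : Vecℚ m) → InLin F z → ⟨ u i , z ⟩ ≡ 0ℚ) →
  (∀ i → InLin F (toℚ (dir i) ⊖ u i)) →
  -- C = (⟨n_i,n_j⟩), M = (⟨u_i,u_j⟩) are mutually inverse
  let C : Mat k
      C i j = ⟨ toℚ (n i) , toℚ (n j) ⟩
      M : Mat k
      M i j = ⟨ u i , u j ⟩
  in (∀ i j → (C ⊗ M) i j ≡ Id i j) × (∀ i j → (M ⊗ C) i j ≡ Id i j)

-- For k > 0, v is a vertex of P as an endpoint of
-- the edge towards v_1; for k = 0 both matrices are empty.
corollary3p7 {k = zero} _ _ _ _ _ _ _ _ _ _ _ _ _ _ _ _ _ _ _ _ _ _ _ _ _ _ _ = (λ ()) , (λ ())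
corollary3p7 {k = suc _} P tu full F F-face _ _ _ n b valid facet n-primitive supporting distinct complete
             v v-vertex w adjacent w∉Fᵢ dir dir-primitive dir-edge u u⊥linF dir-u∈linF =
  SupportingFacets.Gram-normals-inverse P tu full F F-face n b valid facet n-primitive supporting distinct complete
    v (IsVertex⇒member v-vertex) (proj₁ (adjacent zero)) w adjacent w∉Fᵢ dir dir-primitive dir-edge u u⊥linF dir-u∈linF
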